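{- Let $X_{4n^2}$ be the matrix $$X_{4n^2} = \begin{bmatrix} G & F & -F \\ E & A & B \\ -E & B & A \end{bmatrix}$$ constructed as described in the context. Then $X_{4n^2}$ is a QOD$(4n^2; 4ns_1,4ns_2,\dots,4ns_u)$.
   Context: Let $x_1,\dots,x_u$ be complex indeterminates. A (restricted) quaternionic orthogonal design QOD$(n;s_1,\dots,s_u)$ is a square matrix $X$ of order $n$ with entries from $\{0,\pm\varepsilon_\ell x_\ell,\pm\varepsilon_\ell x_\ell^*\mid 1\le \ell\le u,\ \varepsilon_\ell\in\{1,i,j,k\}\}$ such that $XX^*=\sigma I_n$ with $\sigma=\sum_{\ell=1}^u s_\ell|x_\ell|^2$. A quaternionic Hadamard matrix of order $n$ has entries in $\{\pm1,\pm i,\pm j,\pm k\}$ and satisfies $H_nH_n^*=nI_n$. Construction: Let $X_n$ be a QOD$(n;s_1,\dots,s_u)$ with $\sum_i s_i=n$, and let $H_n$ be a quaternionic Hadamard matrix of order $n$. Put $H_{2n}=\left[\begin{smallmatrix}1&1\\1&-1\end{smallmatrix}\right]\otimes H_n$ and $X_{2n}=\left[\begin{smallmatrix}1&1\\1&-1\end{smallmatrix}\right]\otimes X_n$. Denote the rows of $H_n$, $H_{2n}$, $X_n$, $X_{2n}$ by $h_i$, $\hat h_j$, $r_i$, $\hat r_j$ respectively ($0\le i<n$, $0\le j<2n$). Let $C_i=h_i^*r_i$ ($n\times n$ matrices), and define the block circulant matrices $A=\mathrm{circ}(C_0,C_1,\dots,C_{n-1},C_{n-1},\dots,C_1)$ and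 $B=\mathrm{circ}(C_0,C_1,\dots,C_{n-1},-C_{n-1},\dots,-C_1)$ (each with $2n-1$ block positions). Let $E_i=h_0^*\hat r_i$ and $F_i=\hat h_i^*r_0$ for $1\le i\le 2n-1$, let $E$ be the block column $[E_1^*\ \cdots\ E_{2n-1}^*]^*$ (so $E^*=[E_1^*\cdots E_{2n-1}^*]$), let $F=[F_1\ \cdots\ F_{2n-1}]$ (block row), and let $G=\hat h_0^*\hat r_0$. -}

module Defs where

open import Level using (0ℓ)
open import Algebra.Bundles using (CommutativeRing)
open import Data.Nat as ℕ using (ℕ; zero; suc; _∸_; _≤ᵇ_; _<ᵇ_; _≡ᵇ_; _<_; NonZero)
open import Data.Nat.DivMod using (_/_; _%_)
open import Data.Bool using (Bool; true; false; if_then_else_; _xor_; _∧_; not)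
open import Data.Fin using (Fin)

data QUnit : Set where
  𝟙 𝕚 𝕛 𝕜 : QUnit

-- su neg e  represents  (-1)^neg · e
record SUnit : Set where
  constructor su
  field
    neg  : Bool
    unit : QUnit

negSU : SUnit → SUnit
negSU (su b e) = su (not b) e

unitMul : QUnit → QUnit → SUnit
unitMul 𝟙 e = su false e
unitMul 𝕚 𝟙 = su false 𝕚
unitMul 𝕚 𝕚 = su true 𝟙
unitMul 𝕚 𝕛 = su false 𝕜
unitMul 𝕚 𝕜 = su true 𝕛
unitMul 𝕛 𝟙 = su false 𝕛
unitMul 𝕛 𝕚 = su true 𝕜
unitMul 𝕛 𝕛 = su true 𝟙
unitMul 𝕛 𝕜 = su false 𝕚
unitMul 𝕜 𝟙 = su false 𝕜
unitMul 𝕜 𝕚 = su false 𝕛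
unitMul 𝕜 𝕛 = su true 𝕚
unitMul 𝕜 𝕜 = su true 𝟙

mulSU : SUnit → SUnit → SUnit
mulSU (su a e) (su b f) = su (a xor b xor SUnit.neg (unitMul e f)) (SUnit.unit (unitMul e f))

conjSU : SUnit → SUnit
conjSU (su b 𝟙) = su b 𝟙
conjSU (su b 𝕚) = su (not b) 𝕚
conjSU (su b 𝕛) = su (not b) 𝕛
conjSU (su b 𝕜) = su (not b) 𝕜

-- Entries of a (restricted) quaternionic orthogonal design:
--   0,  ±ε x_ℓ  or  ±ε x_ℓ^*   (ε ∈ {1,i,j,k})
-- term s ℓ c  represents  s · x_ℓ  (c = false)  or  s · x_ℓ^*  (c = true).

data Entry (u : ℕ) : Set where
  0ₑ   : Entry u
  term : SUnit → Fin u → Bool → Entry u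

negE : ∀ {u} → Entry u → Entry u
negE 0ₑ = 0ₑ
negE (term s ℓ c) = term (negSU s) ℓ c

lmulE : ∀ {u} → SUnit → Entry u → Entry u
lmulE t 0ₑ = 0ₑ
lmulE t (term s ℓ c) = term (mulSU t s) ℓ c

-- Matrices are indexed by ℕ; only indices below the order matter.
SMat : ℕ → Set
SMat u = ℕ → ℕ → Entry u

HMat : Set
HMat = ℕ → ℕ → SUnit

-- [[1,1],[1,-1]] ⊗ M  for an n×n matrix M (giving a 2n×2n matrix)

sel : ℕ → ℕ → ℕ
sel n p = if n ≤ᵇ p then p ∸ n else p

kronH : ℕ → HMat → HMat
kronH n H p q = if (n ≤ᵇ p) ∧ (n ≤ᵇ q) then negSU (H (sel n p) (sel n q)) else H (sel n p) (sel n q)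

kronX : ∀ {u} → ℕ → SMat u → SMat u
kronX n X p q = if (n ≤ᵇ p) ∧ (n ≤ᵇ q) then negE (X (sel n p) (sel n q)) else X (sel n p) (sel n q)

data Region : Set where
  top mid bot : ℕ → Region

module Construction (n : ℕ) .{{_ : NonZero n}} {u : ℕ} (H : HMat) (X : SMat u) where

  H₂ : HMat
  H₂ = kronH n H

  X₂ : SMat u
  X₂ = kronX n X

  -- C_i = h_i^* r_i   (n × n)
  C : ℕ → SMat u
  C i a b = lmulE (conjSU (H i a)) (X i b)

  -- E_i = h_0^* r̂_i   (n × 2n)
  E : ℕ → SMat u
  E i a b = lmulE (conjSU (H 0 a)) (X₂ i b)

  -- F_i = ĥ_i^* r_0   (2n × n)
  F : ℕ → SMat u
  F i a b = lmulE (conjSU (H₂ i a)) (X 0 b)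

  -- G = ĥ_0^* r̂_0     (2n × 2n)
  G : SMat u
  G a b = lmulE (conjSU (H₂ 0 a)) (X₂ 0 b)

  -- number of block positions of the circulants
  m : ℕ
  m = 2 ℕ.* n ∸ 1

  -- circulant convention: block (k,l) carries the (l - k mod m)-th first-row block
  circIdx : ℕ → ℕ → ℕ
  circIdx k l = if k ≤ᵇ l then l ∸ k else (l ℕ.+ m) ∸ k

  D : Bool → ℕ → SMat u
  D isB t a b = if t <ᵇ n then C t a b
                else (if isB then negE (C (m ∸ t) a b) else C (m ∸ t) a b)

  A : SMat u
  A p q = D false (circIdx (p / n) (q / n)) (p % n) (q % n)

  B : SMat u
  B p q = D true (circIdx (p / n) (q / n)) (p % n) (q % n)

  Ecol : SMat u
  Ecol p q = E (suc (p / n)) (p % n) q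

  Frow : SMat u
  Frow p q = F (suc (q / n)) p (q % n)

  region : ℕ → Region
  region p = if p <ᵇ 2 ℕ.* n then top p
             else (if (p ∸ 2 ℕ.* n) <ᵇ m ℕ.* n then mid (p ∸ 2 ℕ.* n)
                   else bot (p ∸ 2 ℕ.* n ∸ m ℕ.* n))

  blockEntry : Region → Region → Entry u
  blockEntry (top p) (top q) = G p q
  blockEntry (top p) (mid q) = Frow p q
  blockEntry (top p) (bot q) = negE (Frow p q)
  blockEntry (mid p) (top q) = Ecol p q
  blockEntry (mid p) (mid q) = A p q
  blockEntry (mid p) (bot q) = B p q
  blockEntry (bot p) (top q) = negE (Ecol p q)
  blockEntry (bot p) (mid q) = B p q
  blockEntry (bot p) (bot q) = A p q

  X₄ : SMat u
  X₄ p q = blockEntry (region p) (region q)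

X4n² : (n : ℕ) .{{_ : NonZero n}} {u : ℕ} → HMat → SMat u → SMat u
X4n² n H X = Construction.X₄ n H X

-- A commutative ring with involution and an element ι with
-- ι² = -1, ι^* = -ι  (e.g. ℂ[x_ℓ, x_ℓ^*], the ring in which the complex
-- indeterminates live).  Quaternions over it are pairs (a , b) = a + b j
-- (Cayley–Dickson), complex scalars being a + 0 j.

record StarCRing : Set₁ where
  field
    scalars : CommutativeRing 0ℓ 0ℓ
  open CommutativeRing scalars public
  field
    conj       : Carrier → Carrier
    conj-cong  : ∀ {a b} → a ≈ b → conj a ≈ conj b
    conj-+     : ∀ a b → conj (a + b) ≈ conj a + conj b
    conj-*     : ∀ a b → conj (a * b) ≈ conj a * conj b
    conj-1     : conj 1# ≈ 1#
    conj-invol : ∀ a → conj (conj a) ≈ a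
    ι          : Carrier
    ι²         : ι * ι ≈ - 1#
    conj-ι     : conj ι ≈ - ι

sumFin : {A : Set} → A → (A → A → A) → (u : ℕ) → (Fin u → A) → A
sumFin z _⊕_ zero f = z
sumFin z _⊕_ (suc u) f = f Fin.zero ⊕ sumFin z _⊕_ u (λ i → f (Fin.suc i))

sumℕ : ∀ {u} → (Fin u → ℕ) → ℕ
sumℕ {u} = sumFin 0 ℕ._+_ u

module Semantics (R : StarCRing) where
  open StarCRing R

  record ℍ : Set where
    constructor _+ⱼ_
    field
      re : Carrier
      im : Carrier

  _≈ℍ_ : ℍ → ℍ → Set
  (a +ⱼ b) ≈ℍ (c +ⱼ d) = (a ≈ c) Data.Product.× (b ≈ d)
    where import Data.Product

  0ℍ 1ℍ : ℍ
  0ℍ = 0# +ⱼ 0#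
  1ℍ = 1# +ⱼ 0#

  _+ℍ_ : ℍ → ℍ → ℍ
  (a +ⱼ b) +ℍ (c +ⱼ d) = (a + c) +ⱼ (b + d)

  -ℍ_ : ℍ → ℍ
  -ℍ (a +ⱼ b) = (- a) +ⱼ (- b)

  _*ℍ_ : ℍ → ℍ → ℍ
  (a +ⱼ b) *ℍ (c +ⱼ d) = (a * c - b * conj d) +ⱼ (a * d + b * conj c)

  _ℍ* : ℍ → ℍ
  (a +ⱼ b) ℍ* = conj a +ⱼ (- b)

  natMul : ℕ → Carrier → Carrier
  natMul zero a = 0#
  natMul (suc k) a = a + natMul k a

  natℍ : ℕ → ℍ
  natℍ k = natMul k 1# +ⱼ 0#

  sumℍ : ℕ → (ℕ → ℍ) → ℍ
  sumℍ zero f = 0ℍ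
  sumℍ (suc k) f = sumℍ k f +ℍ f k

  evalU : QUnit → ℍ
  evalU 𝟙 = 1# +ⱼ 0#
  evalU 𝕚 = ι +ⱼ 0#
  evalU 𝕛 = 0# +ⱼ 1#
  evalU 𝕜 = 0# +ⱼ ι

  evalSU : SUnit → ℍ
  evalSU (su b e) = if b then -ℍ evalU e else evalU e

  evalE : ∀ {u} → (Fin u → Carrier) → Entry u → ℍ
  evalE x 0ₑ = 0ℍ
  evalE x (term s ℓ c) = evalSU s *ℍ ((if c then conj (x ℓ) else x ℓ) +ⱼ 0#)

  IsOrth : ℕ → (ℕ → ℕ → ℍ) → ℍ → Set
  IsOrth k M σ = ∀ a b → a < k → b < k →
    sumℍ k (λ c → M a c *ℍ (M b c ℍ*)) ≈ℍ (if a ≡ᵇ b then σ else 0ℍ)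

  σ : ∀ {u} → (Fin u → ℕ) → (Fin u → Carrier) → ℍ
  σ {u} s x = sumFin 0# _+_ u (λ ℓ → natMul (s ℓ) (x ℓ * conj (x ℓ))) +ⱼ 0#

-- QOD(k; s_1,…,s_u): X X^* = (Σ s_ℓ |x_ℓ|²) I_k as an identity in the
-- indeterminates, i.e. for every evaluation in every ring as above.
IsQOD : (u k : ℕ) → SMat u → (Fin u → ℕ) → Set₁
IsQOD u k X s = ∀ (R : StarCRing) (x : Fin u → StarCRing.Carrier R) →
  let open Semantics R in IsOrth k (λ a b → evalE x (X a b)) (σ s x)

IsQHadamard : ℕ → HMat → Set₁
IsQHadamard n H = ∀ (R : StarCRing) →
  let open Semantics R in IsOrth n (λ a b → evalSU (H a b)) (natℍ n)

{-# OPTIONS --safe #-}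
-- The inner product of two rows of X₄ₙ² splits over its column blocks. In a
-- column block every entry of a row is ±conj(h)·x with h an entry of H (or of
-- [[H,H],[H,−H]]) and x running along one fixed row of X, so by orthogonality of
-- X the block contributes [same row of X]·(product of the two units)·σ. The
-- column blocks pair up (left/right half of the first block column, l-th blocks
-- of the A- and B-columns) so that both rows use the same row of X and the same
-- entry of H in the two blocks of a pair, up to sign; each pair therefore
-- cancels or doubles, and what survives is a sum of entries of H*H, i.e. 4n·δ.
--
-- Only HH* = nI is assumed, so H*H = nI is derived first, over the Gaussian
-- integers: there Σ_b |(H*H)ab|² = n² = |(H*H)aa|² and norms are sums of integer
-- squares, forcing the off-diagonal entries to vanish. The general case follows
-- because the evaluation of signed units factors through ℤ[i].
module Submission where

open import Defs

open import Level using (0ℓ)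
open import Algebra.Bundles using (CommutativeRing)
open import Data.Nat as ℕ using (ℕ; zero; suc)
import Data.Nat.Properties as ℕ
open import Function using (_∘_)
open import Relation.Nullary.Decidable using (dec-true; dec-false)
open import Data.Integer as ℤ using (ℤ)
import Data.Integer.Properties as ℤ
open import Data.Fin using (Fin)
open import Data.Bool using (Bool; true; false; if_then_else_; not; _xor_; _∧_; T)
open import Relation.Nullary using (yes; no)
open import Relation.Binary.PropositionalEquality as ≡ using (_≡_; _≢_)

-- does (m ℕ.≟ n) is m ℕ.≡ᵇ n by definition; likewise for <? and ≤?.
≡ᵇ-true : ∀ {m n} → m ≡ n → (m ℕ.≡ᵇ n) ≡ true
≡ᵇ-true {m} {n} = dec-true (m ℕ.≟ n)

≡ᵇ-false : ∀ {m n} → m ≢ n → (m ℕ.≡ᵇ n) ≡ false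
≡ᵇ-false {m} {n} = dec-false (m ℕ.≟ n)

≡ᵇ-sound : ∀ {m n} → (m ℕ.≡ᵇ n) ≡ true → m ≡ n
≡ᵇ-sound {m} {n} eq = ℕ.≡ᵇ⇒≡ m n (≡.subst T (≡.sym eq) _)

≡ᵇ-sym : ∀ m n → (m ℕ.≡ᵇ n) ≡ (n ℕ.≡ᵇ m)
≡ᵇ-sym m n with m ℕ.≟ n
... | yes m≡n = ≡.trans (≡ᵇ-true m≡n) (≡.sym (≡ᵇ-true (≡.sym m≡n)))
... | no m≢n = ≡.trans (≡ᵇ-false m≢n) (≡.sym (≡ᵇ-false (m≢n ∘ ≡.sym)))

<ᵇ-true : ∀ {m n} → m ℕ.< n → (m ℕ.<ᵇ n) ≡ true
<ᵇ-true {m} {n} = dec-true (m ℕ.<? n)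

<ᵇ-false : ∀ {m n} → n ℕ.≤ m → (m ℕ.<ᵇ n) ≡ false
<ᵇ-false {m} {n} n≤m = dec-false (m ℕ.<? n) (ℕ.≤⇒≯ n≤m)

≤ᵇ-true : ∀ {m n} → m ℕ.≤ n → (m ℕ.≤ᵇ n) ≡ true
≤ᵇ-true {m} {n} = dec-true (m ℕ.≤? n)

≤ᵇ-false : ∀ {m n} → n ℕ.< m → (m ℕ.≤ᵇ n) ≡ false
≤ᵇ-false {m} {n} n<m = dec-false (m ℕ.≤? n) (ℕ.<⇒≱ n<m)

module IntegerCoefficients (CR : CommutativeRing 0ℓ 0ℓ) where

  open import Data.Integer using (+_; -[1+_]; _⊖_)
  open import Data.Sign as Sign using (Sign)
  open import Data.Maybe as Maybe using (Maybe)
  open import Relation.Nullary.Decidable using (dec⇒maybe)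
  open CommutativeRing CR
  open import Algebra.Properties.Ring ring using (-0#≈0#; -‿involutive; -‿+-comm; -‿distribˡ-*; -‿distribʳ-*)
  open import Algebra.Properties.Semiring.Mult.TCOptimised semiring using (_×_; 1+×; ×-homo-+; ×1-homo-*)
  open import Algebra.Solver.Ring.AlmostCommutativeRing
  import Algebra.Solver.Ring as Solver
  open import Relation.Binary.Reasoning.Setoid setoid

  ⟦_⟧ : ℤ → Carrier
  ⟦ + k ⟧ = k × 1#
  ⟦ -[1+ k ] ⟧ = - (suc k × 1#)

  ⟦⟧-⊖ : ∀ k l → ⟦ k ⊖ l ⟧ ≈ k × 1# - l × 1#
  ⟦⟧-⊖ k zero = sym (trans (+-congˡ -0#≈0#) (+-identityʳ _))
  ⟦⟧-⊖ zero (suc l) = sym (+-identityˡ _)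
  ⟦⟧-⊖ (suc k) (suc l) = begin
    ⟦ suc k ⊖ suc l ⟧                    ≡⟨ ≡.cong ⟦_⟧ (ℤ.[1+m]⊖[1+n]≡m⊖n k l) ⟩
    ⟦ k ⊖ l ⟧                            ≈⟨ ⟦⟧-⊖ k l ⟩
    x - y                                ≈⟨ +-congʳ (+-identityˡ x) ⟨
    0# + x - y                           ≈⟨ +-congʳ (+-congʳ (-‿inverseʳ 1#)) ⟨
    1# - 1# + x - y                      ≈⟨ +-congʳ (+-assoc 1# (- 1#) x) ⟩
    1# + (- 1# + x) - y                  ≈⟨ +-congʳ (+-congˡ (+-comm (- 1#) x)) ⟩
    1# + (x - 1#) - y                    ≈⟨ +-congʳ (+-assoc 1# x (- 1#)) ⟨
    1# + x - 1# - y                      ≈⟨ +-assoc (1# + x) (- 1#) (- y) ⟩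
    1# + x + (- 1# - y)                  ≈⟨ +-congˡ (-‿+-comm 1# y) ⟩
    1# + x - (1# + y)                    ≈⟨ +-cong (1+× k 1#) (-‿cong (1+× l 1#)) ⟨
    suc k × 1# - suc l × 1#              ∎
    where x = k × 1#; y = l × 1#

  ⟦⟧-+ : ∀ i j → ⟦ i ℤ.+ j ⟧ ≈ ⟦ i ⟧ + ⟦ j ⟧
  ⟦⟧-+ (+ k) (+ l) = ×-homo-+ 1# k l
  ⟦⟧-+ (+ k) -[1+ l ] = ⟦⟧-⊖ k (suc l)
  ⟦⟧-+ -[1+ k ] (+ l) = trans (⟦⟧-⊖ l (suc k)) (+-comm _ _)
  ⟦⟧-+ -[1+ k ] -[1+ l ] = begin
    - (suc (suc (k ℕ.+ l)) × 1#)         ≡⟨ ≡.cong (λ t → - (suc t × 1#)) (ℕ.+-suc k l) ⟨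
    - ((suc k ℕ.+ suc l) × 1#)           ≈⟨ -‿cong (×-homo-+ 1# (suc k) (suc l)) ⟩
    - (suc k × 1# + suc l × 1#)          ≈⟨ -‿+-comm _ _ ⟨
    - (suc k × 1#) - (suc l × 1#)        ∎

  signed : Sign → Carrier → Carrier
  signed Sign.+ x = x
  signed Sign.- x = - x

  signed-cong : ∀ s {x y} → x ≈ y → signed s x ≈ signed s y
  signed-cong Sign.+ x≈y = x≈y
  signed-cong Sign.- x≈y = -‿cong x≈y

  signed-* : ∀ s t x y → signed (s Sign.* t) (x * y) ≈ signed s x * signed t y
  signed-* Sign.+ Sign.+ x y = refl
  signed-* Sign.+ Sign.- x y = -‿distribʳ-* x y
  signed-* Sign.- Sign.+ x y = -‿distribˡ-* x y
  signed-* Sign.- Sign.- x y = begin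
    x * y          ≈⟨ -‿involutive _ ⟨
    - - (x * y)    ≈⟨ -‿cong (-‿distribˡ-* x y) ⟩
    - (- x * y)    ≈⟨ -‿distribʳ-* (- x) y ⟩
    - x * - y      ∎

  ⟦⟧-◃ : ∀ s k → ⟦ s ℤ.◃ k ⟧ ≈ signed s (k × 1#)
  ⟦⟧-◃ Sign.+ zero = refl
  ⟦⟧-◃ Sign.- zero = sym -0#≈0#
  ⟦⟧-◃ Sign.+ (suc k) = refl
  ⟦⟧-◃ Sign.- (suc k) = refl

  ⟦⟧-sign-abs : ∀ i → ⟦ i ⟧ ≈ signed (ℤ.sign i) (ℤ.∣ i ∣ × 1#)
  ⟦⟧-sign-abs (+ k) = refl
  ⟦⟧-sign-abs -[1+ k ] = refl

  ⟦⟧-* : ∀ i j → ⟦ i ℤ.* j ⟧ ≈ ⟦ i ⟧ * ⟦ j ⟧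
  ⟦⟧-* i j = begin
    ⟦ (s Sign.* t) ℤ.◃ (k ℕ.* l) ⟧            ≈⟨ ⟦⟧-◃ (s Sign.* t) (k ℕ.* l) ⟩
    signed (s Sign.* t) ((k ℕ.* l) × 1#)      ≈⟨ signed-cong (s Sign.* t) (×1-homo-* k l) ⟩
    signed (s Sign.* t) (k × 1# * l × 1#)     ≈⟨ signed-* s t _ _ ⟩
    signed s (k × 1#) * signed t (l × 1#)     ≈⟨ *-cong (⟦⟧-sign-abs i) (⟦⟧-sign-abs j) ⟨
    ⟦ i ⟧ * ⟦ j ⟧                             ∎
    where s = ℤ.sign i; t = ℤ.sign j; k = ℤ.∣ i ∣; l = ℤ.∣ j ∣

  ⟦⟧-neg : ∀ i → ⟦ ℤ.- i ⟧ ≈ - ⟦ i ⟧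
  ⟦⟧-neg (+ zero) = sym -0#≈0#
  ⟦⟧-neg (+ suc k) = refl
  ⟦⟧-neg -[1+ k ] = sym (-‿involutive _)

  ℤ⟶CR : ℤ.+-*-rawRing -Raw-AlmostCommutative⟶ fromCommutativeRing CR
  ℤ⟶CR = record
    { ⟦_⟧ = ⟦_⟧ ; +-homo = ⟦⟧-+ ; *-homo = ⟦⟧-* ; -‿homo = ⟦⟧-neg ; 0-homo = refl ; 1-homo = refl }

  ⟦⟧-≟ : ∀ i j → Maybe (⟦ i ⟧ ≈ ⟦ j ⟧)
  ⟦⟧-≟ i j = Maybe.map (reflexive ∘ ≡.cong ⟦_⟧) (dec⇒maybe (i ℤ.≟ j))
  open Solver ℤ.+-*-rawRing (fromCommutativeRing CR) ℤ⟶CR ⟦⟧-≟ public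
    using (Polynomial; solve; _:=_; _:+_; _:*_; _:-_; :-_; con)

  :0 :1 : ∀ {k} → Polynomial k
  :0 = con (+ 0)
  :1 = con (+ 1)

module QuaternionAlgebra (R : StarCRing) where

  open StarCRing R
  open Semantics R public
  open IntegerCoefficients scalars using (solve; _:=_; _:+_; _:*_; _:-_; :-_; :0; :1)
  open import Algebra.Properties.Ring ring using (-0#≈0#; -‿involutive; -‿+-comm; x+x≈x⇒x≈0; +-inverseˡ-unique)
  open import Algebra.Properties.Semiring.Mult semiring using (_×_; ×-congʳ; ×-homo-+; ×-assocˡ; ×-assoc-*)
  open import Data.Product using (_,_)
  open import Relation.Binary.Bundles using (Setoid)
  import Relation.Binary.Reasoning.Setoid as SetoidReasoning

  conj-0 : conj 0# ≈ 0#
  conj-0 = x+x≈x⇒x≈0 (conj 0#) (trans (sym (conj-+ 0# 0#)) (conj-cong (+-identityʳ 0#)))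

  conj-neg : ∀ a → conj (- a) ≈ - conj a
  conj-neg a = +-inverseˡ-unique (conj (- a)) (conj a) (trans (sym (conj-+ (- a) a)) (trans (conj-cong (-‿inverseˡ a)) conj-0))

  conj-- : ∀ a b → conj (a - b) ≈ conj a - conj b
  conj-- a b = trans (conj-+ a (- b)) (+-congˡ (conj-neg b))

  ≈ℍ-refl : ∀ {p} → p ≈ℍ p
  ≈ℍ-refl = refl , refl

  ≈ℍ-sym : ∀ {p q} → p ≈ℍ q → q ≈ℍ p
  ≈ℍ-sym (e₁ , e₂) = sym e₁ , sym e₂

  ≈ℍ-trans : ∀ {p q r} → p ≈ℍ q → q ≈ℍ r → p ≈ℍ r
  ≈ℍ-trans (e₁ , e₂) (f₁ , f₂) = trans e₁ f₁ , trans e₂ f₂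

  ≈ℍ-reflexive : ∀ {p q} → p ≡ q → p ≈ℍ q
  ≈ℍ-reflexive ≡.refl = ≈ℍ-refl

  ℍ-setoid : Setoid 0ℓ 0ℓ
  ℍ-setoid = record
    { Carrier = ℍ ; _≈_ = _≈ℍ_
    ; isEquivalence = record { refl = ≈ℍ-refl ; sym = ≈ℍ-sym ; trans = ≈ℍ-trans } }

  module ℍ-Reasoning = SetoidReasoning ℍ-setoid

  +ℍ-cong : ∀ {p p′ q q′} → p ≈ℍ p′ → q ≈ℍ q′ → (p +ℍ q) ≈ℍ (p′ +ℍ q′)
  +ℍ-cong (a , b) (c , d) = +-cong a c , +-cong b d

  -ℍ-cong : ∀ {p q} → p ≈ℍ q → (-ℍ p) ≈ℍ (-ℍ q)
  -ℍ-cong (a , b) = -‿cong a , -‿cong b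

  *ℍ-cong : ∀ {p p′ q q′} → p ≈ℍ p′ → q ≈ℍ q′ → (p *ℍ q) ≈ℍ (p′ *ℍ q′)
  *ℍ-cong (a , b) (c , d) =
    +-cong (*-cong a c) (-‿cong (*-cong b (conj-cong d))) ,
    +-cong (*-cong a d) (*-cong b (conj-cong c))

  ℍ*-cong : ∀ {p q} → p ≈ℍ q → (p ℍ*) ≈ℍ (q ℍ*)
  ℍ*-cong (a , b) = conj-cong a , -‿cong b

  +ℍ-assoc : ∀ p q r → ((p +ℍ q) +ℍ r) ≈ℍ (p +ℍ (q +ℍ r))
  +ℍ-assoc _ _ _ = +-assoc _ _ _ , +-assoc _ _ _

  +ℍ-comm : ∀ p q → (p +ℍ q) ≈ℍ (q +ℍ p)
  +ℍ-comm _ _ = +-comm _ _ , +-comm _ _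

  +ℍ-identityˡ : ∀ p → (0ℍ +ℍ p) ≈ℍ p
  +ℍ-identityˡ _ = +-identityˡ _ , +-identityˡ _

  +ℍ-identityʳ : ∀ p → (p +ℍ 0ℍ) ≈ℍ p
  +ℍ-identityʳ _ = +-identityʳ _ , +-identityʳ _

  -ℍ-inverseˡ : ∀ p → ((-ℍ p) +ℍ p) ≈ℍ 0ℍ
  -ℍ-inverseˡ _ = -‿inverseˡ _ , -‿inverseˡ _

  -ℍ-inverseʳ : ∀ p → (p +ℍ (-ℍ p)) ≈ℍ 0ℍ
  -ℍ-inverseʳ _ = -‿inverseʳ _ , -‿inverseʳ _

  -ℍ-involutive : ∀ p → (-ℍ (-ℍ p)) ≈ℍ p
  -ℍ-involutive _ = -‿involutive _ , -‿involutive _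

  -ℍ-+ : ∀ p q → (-ℍ (p +ℍ q)) ≈ℍ ((-ℍ p) +ℍ (-ℍ q))
  -ℍ-+ _ _ = sym (-‿+-comm _ _) , sym (-‿+-comm _ _)

  -ℍ-0 : (-ℍ 0ℍ) ≈ℍ 0ℍ
  -ℍ-0 = -0#≈0# , -0#≈0#

  +ℍ-interchange : ∀ p q r s → ((p +ℍ q) +ℍ (r +ℍ s)) ≈ℍ ((p +ℍ r) +ℍ (q +ℍ s))
  +ℍ-interchange p q r s = begin
    (p +ℍ q) +ℍ (r +ℍ s)  ≈⟨ +ℍ-assoc p q _ ⟩
    p +ℍ (q +ℍ (r +ℍ s))  ≈⟨ +ℍ-cong ≈ℍ-refl (+ℍ-assoc q r s) ⟨
    p +ℍ ((q +ℍ r) +ℍ s)  ≈⟨ +ℍ-cong ≈ℍ-refl (+ℍ-cong (+ℍ-comm q r) ≈ℍ-refl) ⟩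
    p +ℍ ((r +ℍ q) +ℍ s)  ≈⟨ +ℍ-cong ≈ℍ-refl (+ℍ-assoc r q s) ⟩
    p +ℍ (r +ℍ (q +ℍ s))  ≈⟨ +ℍ-assoc p r _ ⟨
    (p +ℍ r) +ℍ (q +ℍ s)  ∎
    where open ℍ-Reasoning

  *ℍ-assoc : ∀ p q r → ((p *ℍ q) *ℍ r) ≈ℍ (p *ℍ (q *ℍ r))
  *ℍ-assoc (a +ⱼ b) (c +ⱼ d) (e +ⱼ f) = re , im
    where
    open SetoidReasoning setoid
    conj-im : conj (c * f + d * conj e) ≈ conj c * conj f + conj d * e
    conj-im = trans (conj-+ _ _) (+-cong (conj-* _ _) (trans (conj-* _ _) (*-congˡ (conj-invol e))))
    conj-re : conj (c * e - d * conj f) ≈ conj c * conj e - conj d * f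
    conj-re = trans (conj-- _ _) (+-cong (conj-* _ _) (-‿cong (trans (conj-* _ _) (*-congˡ (conj-invol f)))))
    re : (a * c - b * conj d) * e - (a * d + b * conj c) * conj f ≈ a * (c * e - d * conj f) - b * conj (c * f + d * conj e)
    re = begin
      (a * c - b * conj d) * e - (a * d + b * conj c) * conj f
        ≈⟨ solve 8 (λ a b c d e f c̄ d̄ → (a :* c :- b :* d̄) :* e :- (a :* d :+ b :* c̄) :* f
                  := a :* (c :* e :- d :* f) :- b :* (c̄ :* f :+ d̄ :* e)) refl a b c d e (conj f) (conj c) (conj d) ⟩
      a * (c * e - d * conj f) - b * (conj c * conj f + conj d * e)  ≈⟨ +-congˡ (-‿cong (*-congˡ conj-im)) ⟨
      a * (c * e - d * conj f) - b * conj (c * f + d * conj e)       ∎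
    im : (a * c - b * conj d) * f + (a * d + b * conj c) * conj e ≈ a * (c * f + d * conj e) + b * conj (c * e - d * conj f)
    im = begin
      (a * c - b * conj d) * f + (a * d + b * conj c) * conj e
        ≈⟨ solve 9 (λ a b c d e f c̄ d̄ ē → (a :* c :- b :* d̄) :* f :+ (a :* d :+ b :* c̄) :* ē
                  := a :* (c :* f :+ d :* ē) :+ b :* (c̄ :* ē :- d̄ :* f)) refl a b c d e f (conj c) (conj d) (conj e) ⟩
      a * (c * f + d * conj e) + b * (conj c * conj e - conj d * f)  ≈⟨ +-congˡ (*-congˡ conj-re) ⟨
      a * (c * f + d * conj e) + b * conj (c * e - d * conj f)       ∎

  *ℍ-distribˡ : ∀ p q r → (p *ℍ (q +ℍ r)) ≈ℍ ((p *ℍ q) +ℍ (p *ℍ r))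
  *ℍ-distribˡ (a +ⱼ b) (c +ⱼ d) (e +ⱼ f) =
    trans (+-congˡ (-‿cong (*-congˡ (conj-+ d f))))
      (solve 8 (λ a b c d e f d̄ f̄ → a :* (c :+ e) :- b :* (d̄ :+ f̄) := (a :* c :- b :* d̄) :+ (a :* e :- b :* f̄))
             refl a b c d e f (conj d) (conj f)) ,
    trans (+-congˡ (*-congˡ (conj-+ c e)))
      (solve 8 (λ a b c d e f c̄ ē → a :* (d :+ f) :+ b :* (c̄ :+ ē) := (a :* d :+ b :* c̄) :+ (a :* f :+ b :* ē))
             refl a b c d e f (conj c) (conj e))

  *ℍ-distribʳ : ∀ p q r → ((q +ℍ r) *ℍ p) ≈ℍ ((q *ℍ p) +ℍ (r *ℍ p))
  *ℍ-distribʳ (a +ⱼ b) (c +ⱼ d) (e +ⱼ f) =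
    solve 6 (λ a b̄ c d e f → (c :+ e) :* a :- (d :+ f) :* b̄ := (c :* a :- d :* b̄) :+ (e :* a :- f :* b̄))
          refl a (conj b) c d e f ,
    solve 6 (λ ā b c d e f → (c :+ e) :* b :+ (d :+ f) :* ā := (c :* b :+ d :* ā) :+ (e :* b :+ f :* ā))
          refl (conj a) b c d e f

  *ℍ-zeroˡ : ∀ p → (0ℍ *ℍ p) ≈ℍ 0ℍ
  *ℍ-zeroˡ (a +ⱼ b) = solve 2 (λ a b̄ → :0 :* a :- :0 :* b̄ := :0) refl a (conj b) ,
                      solve 2 (λ ā b → :0 :* b :+ :0 :* ā := :0) refl (conj a) b

  *ℍ-zeroʳ : ∀ p → (p *ℍ 0ℍ) ≈ℍ 0ℍ
  *ℍ-zeroʳ (a +ⱼ b) =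
    trans (+-congˡ (-‿cong (*-congˡ conj-0))) (solve 2 (λ a b → a :* :0 :- b :* :0 := :0) refl a b) ,
    trans (+-congˡ (*-congˡ conj-0)) (solve 2 (λ a b → a :* :0 :+ b :* :0 := :0) refl a b)

  *ℍ-identityˡ : ∀ p → (1ℍ *ℍ p) ≈ℍ p
  *ℍ-identityˡ (a +ⱼ b) = solve 2 (λ a b̄ → :1 :* a :- :0 :* b̄ := a) refl a (conj b) ,
                          solve 2 (λ ā b → :1 :* b :+ :0 :* ā := b) refl (conj a) b

  *ℍ-negˡ : ∀ p q → ((-ℍ p) *ℍ q) ≈ℍ (-ℍ (p *ℍ q))
  *ℍ-negˡ (a +ⱼ b) (c +ⱼ d) =
    solve 4 (λ a b c d̄ → (:- a) :* c :- (:- b) :* d̄ := :- (a :* c :- b :* d̄)) refl a b c (conj d) ,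
    solve 4 (λ a b c̄ d → (:- a) :* d :+ (:- b) :* c̄ := :- (a :* d :+ b :* c̄)) refl a b (conj c) d

  *ℍ-negʳ : ∀ p q → (p *ℍ (-ℍ q)) ≈ℍ (-ℍ (p *ℍ q))
  *ℍ-negʳ (a +ⱼ b) (c +ⱼ d) =
    trans (+-congˡ (-‿cong (*-congˡ (conj-neg d))))
      (solve 4 (λ a b c d̄ → a :* (:- c) :- b :* (:- d̄) := :- (a :* c :- b :* d̄)) refl a b c (conj d)) ,
    trans (+-congˡ (*-congˡ (conj-neg c)))
      (solve 4 (λ a b c̄ d → a :* (:- d) :+ b :* (:- c̄) := :- (a :* d :+ b :* c̄)) refl a b (conj c) d)

  ℍ*-involutive : ∀ p → ((p ℍ*) ℍ*) ≈ℍ p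
  ℍ*-involutive (a +ⱼ b) = conj-invol a , -‿involutive b

  ℍ*-+ : ∀ p q → ((p +ℍ q) ℍ*) ≈ℍ ((p ℍ*) +ℍ (q ℍ*))
  ℍ*-+ (a +ⱼ b) (c +ⱼ d) = conj-+ a c , sym (-‿+-comm b d)

  ℍ*-neg : ∀ p → ((-ℍ p) ℍ*) ≈ℍ (-ℍ (p ℍ*))
  ℍ*-neg (a +ⱼ b) = conj-neg a , refl

  ℍ*-0 : (0ℍ ℍ*) ≈ℍ 0ℍ
  ℍ*-0 = conj-0 , -0#≈0#

  ℍ*-anti-* : ∀ p q → ((p *ℍ q) ℍ*) ≈ℍ ((q ℍ*) *ℍ (p ℍ*))
  ℍ*-anti-* (a +ⱼ b) (c +ⱼ d) = re , im
    where
    open SetoidReasoning setoid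
    re : conj (a * c - b * conj d) ≈ conj c * conj a - (- d) * conj (- b)
    re = begin
      conj (a * c - b * conj d)          ≈⟨ conj-- _ _ ⟩
      conj (a * c) - conj (b * conj d)   ≈⟨ +-cong (conj-* a c) (-‿cong (trans (conj-* _ _) (*-congˡ (conj-invol d)))) ⟩
      conj a * conj c - conj b * d
        ≈⟨ solve 4 (λ ā c̄ b̄ d → ā :* c̄ :- b̄ :* d := c̄ :* ā :- (:- d) :* (:- b̄)) refl (conj a) (conj c) (conj b) d ⟩
      conj c * conj a - (- d) * (- conj b)  ≈⟨ +-congˡ (-‿cong (*-congˡ (conj-neg b))) ⟨
      conj c * conj a - (- d) * conj (- b)  ∎
    im : - (a * d + b * conj c) ≈ conj c * (- b) + (- d) * conj (conj a)
    im = begin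
      - (a * d + b * conj c)
        ≈⟨ solve 4 (λ a d b c̄ → :- (a :* d :+ b :* c̄) := c̄ :* (:- b) :+ (:- d) :* a) refl a d b (conj c) ⟩
      conj c * (- b) + (- d) * a              ≈⟨ +-congˡ (*-congˡ (conj-invol a)) ⟨
      conj c * (- b) + (- d) * conj (conj a)  ∎

  real-central : ∀ s p → conj s ≈ s → ((s +ⱼ 0#) *ℍ p) ≈ℍ (p *ℍ (s +ⱼ 0#))
  real-central s (a +ⱼ b) s-real =
    trans (solve 4 (λ s a b b̄ → s :* a :- :0 :* b̄ := a :* s :- b :* :0) refl s a b (conj b))
          (+-congˡ (-‿cong (*-congˡ (sym conj-0)))) ,
    trans (solve 4 (λ s a ā b → s :* b :+ :0 :* ā := a :* :0 :+ b :* s) refl s a (conj a) b)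
          (+-congˡ (*-congˡ (sym s-real)))

  natMul≡× : ∀ k a → natMul k a ≡ k × a
  natMul≡× zero a = ≡.refl
  natMul≡× (suc k) a = ≡.cong (_+_ a) (natMul≡× k a)

  natMul-cong : ∀ k {a b} → a ≈ b → natMul k a ≈ natMul k b
  natMul-cong k {a} {b} a≈b rewrite natMul≡× k a | natMul≡× k b = ×-congʳ k a≈b

  natMul-+ : ∀ k l a → natMul (k ℕ.+ l) a ≈ natMul k a + natMul l a
  natMul-+ k l a rewrite natMul≡× (k ℕ.+ l) a | natMul≡× k a | natMul≡× l a = ×-homo-+ a k l

  natMul-* : ∀ k l a → natMul (k ℕ.* l) a ≈ natMul k 1# * natMul l a
  natMul-* k l a rewrite natMul≡× (k ℕ.* l) a | natMul≡× k 1# | natMul≡× l a =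
    trans (sym (×-assocˡ a k l)) (sym (trans (×-assoc-* k 1# _) (×-congʳ k (*-identityˡ _))))

  conj-natMul : ∀ k a → conj (natMul k a) ≈ natMul k (conj a)
  conj-natMul zero a = conj-0
  conj-natMul (suc k) a = trans (conj-+ _ _) (+-congˡ (conj-natMul k a))

  natℍ-central : ∀ k p → (natℍ k *ℍ p) ≈ℍ (p *ℍ natℍ k)
  natℍ-central k p = real-central (natMul k 1#) p (trans (conj-natMul k 1#) (natMul-cong k conj-1))

  natℍ-+ : ∀ k l → natℍ (k ℕ.+ l) ≈ℍ (natℍ k +ℍ natℍ l)
  natℍ-+ k l = natMul-+ k l 1# , sym (+-identityʳ 0#)

module QuaternionSums (R : StarCRing) where

  open QuaternionAlgebra R public
  open import Data.Nat using (_<_; _+_; _*_; _∸_; _≡ᵇ_)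
  open import Data.Product using (_,_)
  import Data.Nat.Properties as ℕ

  sum-cong : ∀ k {f g} → (∀ i → i < k → f i ≈ℍ g i) → sumℍ k f ≈ℍ sumℍ k g
  sum-cong zero f≈g = ≈ℍ-refl
  sum-cong (suc k) f≈g = +ℍ-cong (sum-cong k (λ i i<k → f≈g i (ℕ.m<n⇒m<1+n i<k))) (f≈g k ℕ.≤-refl)

  sum-congˡ : ∀ {k l} f → k ≡ l → sumℍ k f ≈ℍ sumℍ l f
  sum-congˡ f ≡.refl = ≈ℍ-refl

  sum-zero : ∀ k f → (∀ i → i < k → f i ≈ℍ 0ℍ) → sumℍ k f ≈ℍ 0ℍ
  sum-zero k f f≈0 = ≈ℍ-trans (sum-cong k f≈0) (zeros k)
    where
    zeros : ∀ k → sumℍ k (λ _ → 0ℍ) ≈ℍ 0ℍ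
    zeros zero = ≈ℍ-refl
    zeros (suc k) = ≈ℍ-trans (+ℍ-identityʳ _) (zeros k)

  sum-+ : ∀ k f g → sumℍ k (λ i → f i +ℍ g i) ≈ℍ (sumℍ k f +ℍ sumℍ k g)
  sum-+ zero f g = ≈ℍ-sym (+ℍ-identityˡ _)
  sum-+ (suc k) f g = ≈ℍ-trans (+ℍ-cong (sum-+ k f g) ≈ℍ-refl) (+ℍ-interchange _ _ _ _)

  sum-neg : ∀ k f → sumℍ k (λ i → -ℍ f i) ≈ℍ (-ℍ sumℍ k f)
  sum-neg zero f = ≈ℍ-sym -ℍ-0
  sum-neg (suc k) f = ≈ℍ-trans (+ℍ-cong (sum-neg k f) ≈ℍ-refl) (≈ℍ-sym (-ℍ-+ _ _))

  sum-*ˡ : ∀ k p f → (p *ℍ sumℍ k f) ≈ℍ sumℍ k (λ i → p *ℍ f i)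
  sum-*ˡ zero p f = *ℍ-zeroʳ p
  sum-*ˡ (suc k) p f = ≈ℍ-trans (*ℍ-distribˡ p _ _) (+ℍ-cong (sum-*ˡ k p f) ≈ℍ-refl)

  sum-*ʳ : ∀ k p f → (sumℍ k f *ℍ p) ≈ℍ sumℍ k (λ i → f i *ℍ p)
  sum-*ʳ zero p f = *ℍ-zeroˡ p
  sum-*ʳ (suc k) p f = ≈ℍ-trans (*ℍ-distribʳ p _ _) (+ℍ-cong (sum-*ʳ k p f) ≈ℍ-refl)

  sum-ℍ* : ∀ k f → (sumℍ k f ℍ*) ≈ℍ sumℍ k (λ i → f i ℍ*)
  sum-ℍ* zero f = ℍ*-0
  sum-ℍ* (suc k) f = ≈ℍ-trans (ℍ*-+ _ _) (+ℍ-cong (sum-ℍ* k f) ≈ℍ-refl)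

  sum-split : ∀ k l f → sumℍ (k + l) f ≈ℍ (sumℍ k f +ℍ sumℍ l (λ i → f (k + i)))
  sum-split k zero f = ≈ℍ-trans (sum-congˡ f (ℕ.+-identityʳ k)) (≈ℍ-sym (+ℍ-identityʳ _))
  sum-split k (suc l) f = begin
    sumℍ (k + suc l) f                                   ≈⟨ sum-congˡ f (ℕ.+-suc k l) ⟩
    sumℍ (k + l) f +ℍ f (k + l)                           ≈⟨ +ℍ-cong (sum-split k l f) ≈ℍ-refl ⟩
    (sumℍ k f +ℍ sumℍ l (λ i → f (k + i))) +ℍ f (k + l)  ≈⟨ +ℍ-assoc _ _ _ ⟩
    sumℍ k f +ℍ sumℍ (suc l) (λ i → f (k + i))           ∎
    where open ℍ-Reasoning

  sum-head : ∀ k f → sumℍ (suc k) f ≈ℍ (f 0 +ℍ sumℍ k (λ i → f (suc i)))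
  sum-head k f = ≈ℍ-trans (sum-split 1 k f) (+ℍ-cong (+ℍ-identityˡ (f 0)) ≈ℍ-refl)

  sum-blocks : ∀ k n f → sumℍ (k * n) f ≈ℍ sumℍ k (λ l → sumℍ n (λ c → f (l * n + c)))
  sum-blocks zero n f = ≈ℍ-refl
  sum-blocks (suc k) n f = begin
    sumℍ (n + k * n) f                                ≈⟨ sum-congˡ f (ℕ.+-comm n (k * n)) ⟩
    sumℍ (k * n + n) f                                ≈⟨ sum-split (k * n) n f ⟩
    sumℍ (k * n) f +ℍ sumℍ n (λ c → f (k * n + c))   ≈⟨ +ℍ-cong (sum-blocks k n f) ≈ℍ-refl ⟩
    sumℍ (suc k) (λ l → sumℍ n (λ c → f (l * n + c))) ∎
    where open ℍ-Reasoning

  sum-comm : ∀ k l (f : ℕ → ℕ → ℍ) → sumℍ k (λ i → sumℍ l (f i)) ≈ℍ sumℍ l (λ j → sumℍ k (λ i → f i j))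
  sum-comm zero l f = ≈ℍ-sym (sum-zero l _ (λ _ _ → ≈ℍ-refl))
  sum-comm (suc k) l f = ≈ℍ-trans (+ℍ-cong (sum-comm k l f) ≈ℍ-refl) (≈ℍ-sym (sum-+ l _ (f k)))

  sum-reverse : ∀ k f → sumℍ k f ≈ℍ sumℍ k (λ i → f (k ∸ suc i))
  sum-reverse zero f = ≈ℍ-refl
  sum-reverse (suc k) f = begin
    sumℍ k f +ℍ f k                       ≈⟨ +ℍ-comm _ _ ⟩
    f k +ℍ sumℍ k f                       ≈⟨ +ℍ-cong ≈ℍ-refl (sum-reverse k f) ⟩
    f k +ℍ sumℍ k (λ i → f (k ∸ suc i))   ≈⟨ sum-head k _ ⟨
    sumℍ (suc k) (λ i → f (suc k ∸ suc i)) ∎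
    where open ℍ-Reasoning

  sum-ones : ∀ k → sumℍ k (λ _ → 1ℍ) ≈ℍ natℍ k
  sum-ones zero = ≈ℍ-refl
  sum-ones (suc k) = ≈ℍ-trans (+ℍ-cong (sum-ones k) ≈ℍ-refl) (StarCRing.+-comm R _ _ , StarCRing.+-identityˡ R _)

  sum-const : ∀ k p → sumℍ k (λ _ → p) ≈ℍ (natℍ k *ℍ p)
  sum-const k p = begin
    sumℍ k (λ _ → p)          ≈⟨ sum-cong k (λ _ _ → *ℍ-identityˡ p) ⟨
    sumℍ k (λ _ → 1ℍ *ℍ p)    ≈⟨ sum-*ʳ k p (λ _ → 1ℍ) ⟨
    sumℍ k (λ _ → 1ℍ) *ℍ p    ≈⟨ *ℍ-cong (sum-ones k) ≈ℍ-refl ⟩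
    natℍ k *ℍ p               ∎
    where open ℍ-Reasoning

  if-*ˡ : ∀ b p q → (p *ℍ (if b then q else 0ℍ)) ≈ℍ (if b then p *ℍ q else 0ℍ)
  if-*ˡ true p q = ≈ℍ-refl
  if-*ˡ false p q = *ℍ-zeroʳ p

  if-*ʳ : ∀ b p q → ((if b then p else 0ℍ) *ℍ q) ≈ℍ (if b then p *ℍ q else 0ℍ)
  if-*ʳ true p q = ≈ℍ-refl
  if-*ʳ false p q = *ℍ-zeroˡ q

  sum-δ : ∀ k c (g : ℕ → ℍ) → c < k → sumℍ k (λ d → if c ≡ᵇ d then g d else 0ℍ) ≈ℍ g c
  sum-δ (suc k) c g c<1+k with c ℕ.≟ k
  ... | yes ≡.refl = begin
    sumℍ k (λ d → if c ≡ᵇ d then g d else 0ℍ) +ℍ (if c ≡ᵇ c then g c else 0ℍ)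
      ≈⟨ +ℍ-cong (sum-zero k _ off-diagonal) (≈ℍ-reflexive (≡.cong (if_then g c else 0ℍ) (≡ᵇ-true {c} ≡.refl))) ⟩
    0ℍ +ℍ g c  ≈⟨ +ℍ-identityˡ _ ⟩
    g c        ∎
    where
    open ℍ-Reasoning
    off-diagonal : ∀ d → d < c → (if c ≡ᵇ d then g d else 0ℍ) ≈ℍ 0ℍ
    off-diagonal d d<c rewrite ≡ᵇ-false (ℕ.>⇒≢ d<c) = ≈ℍ-refl
  ... | no c≢k = begin
    sumℍ k (λ d → if c ≡ᵇ d then g d else 0ℍ) +ℍ (if c ≡ᵇ k then g k else 0ℍ)
      ≈⟨ +ℍ-cong (sum-δ k c g (ℕ.≤∧≢⇒< (ℕ.≤-pred c<1+k) c≢k))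
                 (≈ℍ-reflexive (≡.cong (if_then g k else 0ℍ) (≡ᵇ-false c≢k))) ⟩
    g c +ℍ 0ℍ  ≈⟨ +ℍ-identityʳ _ ⟩
    g c        ∎
    where open ℍ-Reasoning

module GaussianIntegers where

  open import Data.Integer using (+_)
  open import Data.Integer.Tactic.RingSolver using (solve-∀)
  open import Data.Product using (_×_; _,_)
  open import Algebra.Structures using (IsCommutativeRing)
  open ≡ using (cong₂)

  ℤ² : Set
  ℤ² = ℤ × ℤ

  infixl 6 _+ᵍ_
  infixl 7 _*ᵍ_

  _+ᵍ_ _*ᵍ_ : ℤ² → ℤ² → ℤ²
  (a , b) +ᵍ (c , d) = a ℤ.+ c , b ℤ.+ d
  (a , b) *ᵍ (c , d) = a ℤ.* c ℤ.- b ℤ.* d , a ℤ.* d ℤ.+ b ℤ.* c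

  -ᵍ_ conjᵍ : ℤ² → ℤ²
  -ᵍ (a , b) = ℤ.- a , ℤ.- b
  conjᵍ (a , b) = a , ℤ.- b

  private
    *-assoc-re : ∀ a b c d e f → (a ℤ.* c ℤ.- b ℤ.* d) ℤ.* e ℤ.- (a ℤ.* d ℤ.+ b ℤ.* c) ℤ.* f
                                  ≡ a ℤ.* (c ℤ.* e ℤ.- d ℤ.* f) ℤ.- b ℤ.* (c ℤ.* f ℤ.+ d ℤ.* e)
    *-assoc-re = solve-∀
    *-assoc-im : ∀ a b c d e f → (a ℤ.* c ℤ.- b ℤ.* d) ℤ.* f ℤ.+ (a ℤ.* d ℤ.+ b ℤ.* c) ℤ.* e
                                  ≡ a ℤ.* (c ℤ.* f ℤ.+ d ℤ.* e) ℤ.+ b ℤ.* (c ℤ.* e ℤ.- d ℤ.* f)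
    *-assoc-im = solve-∀
    *-identityˡ-re : ∀ c d → + 1 ℤ.* c ℤ.- + 0 ℤ.* d ≡ c
    *-identityˡ-re = solve-∀
    *-identityˡ-im : ∀ c d → + 1 ℤ.* d ℤ.+ + 0 ℤ.* c ≡ d
    *-identityˡ-im = solve-∀
    *-identityʳ-re : ∀ c d → c ℤ.* + 1 ℤ.- d ℤ.* + 0 ≡ c
    *-identityʳ-re = solve-∀
    *-identityʳ-im : ∀ c d → c ℤ.* + 0 ℤ.+ d ℤ.* + 1 ≡ d
    *-identityʳ-im = solve-∀
    distribˡ-re : ∀ a b c d e f → a ℤ.* (c ℤ.+ e) ℤ.- b ℤ.* (d ℤ.+ f) ≡ (a ℤ.* c ℤ.- b ℤ.* d) ℤ.+ (a ℤ.* e ℤ.- b ℤ.* f)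
    distribˡ-re = solve-∀
    distribˡ-im : ∀ a b c d e f → a ℤ.* (d ℤ.+ f) ℤ.+ b ℤ.* (c ℤ.+ e) ≡ (a ℤ.* d ℤ.+ b ℤ.* c) ℤ.+ (a ℤ.* f ℤ.+ b ℤ.* e)
    distribˡ-im = solve-∀
    distribʳ-re : ∀ a b c d e f → (c ℤ.+ e) ℤ.* a ℤ.- (d ℤ.+ f) ℤ.* b ≡ (c ℤ.* a ℤ.- d ℤ.* b) ℤ.+ (e ℤ.* a ℤ.- f ℤ.* b)
    distribʳ-re = solve-∀
    distribʳ-im : ∀ a b c d e f → (c ℤ.+ e) ℤ.* b ℤ.+ (d ℤ.+ f) ℤ.* a ≡ (c ℤ.* b ℤ.+ d ℤ.* a) ℤ.+ (e ℤ.* b ℤ.+ f ℤ.* a)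
    distribʳ-im = solve-∀
    *-comm-re : ∀ a b c d → a ℤ.* c ℤ.- b ℤ.* d ≡ c ℤ.* a ℤ.- d ℤ.* b
    *-comm-re = solve-∀
    *-comm-im : ∀ a b c d → a ℤ.* d ℤ.+ b ℤ.* c ≡ c ℤ.* b ℤ.+ d ℤ.* a
    *-comm-im = solve-∀
    conj-*-re : ∀ a b c d → a ℤ.* c ℤ.- b ℤ.* d ≡ a ℤ.* c ℤ.- ℤ.- b ℤ.* ℤ.- d
    conj-*-re = solve-∀
    conj-*-im : ∀ a b c d → ℤ.- (a ℤ.* d ℤ.+ b ℤ.* c) ≡ a ℤ.* ℤ.- d ℤ.+ ℤ.- b ℤ.* c
    conj-*-im = solve-∀

  isCommutativeRing : IsCommutativeRing _≡_ _+ᵍ_ _*ᵍ_ -ᵍ_ (+ 0 , + 0) (+ 1 , + 0)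
  isCommutativeRing = record
    { isRing = record
      { +-isAbelianGroup = record
        { isGroup = record
          { isMonoid = record
            { isSemigroup = record
              { isMagma = record { isEquivalence = ≡.isEquivalence ; ∙-cong = cong₂ _+ᵍ_ }
              ; assoc = λ { (a , b) (c , d) (e , f) → cong₂ _,_ (ℤ.+-assoc a c e) (ℤ.+-assoc b d f) } }
            ; identity = (λ { (a , b) → cong₂ _,_ (ℤ.+-identityˡ a) (ℤ.+-identityˡ b) })
                       , (λ { (a , b) → cong₂ _,_ (ℤ.+-identityʳ a) (ℤ.+-identityʳ b) }) }
          ; inverse = (λ { (a , b) → cong₂ _,_ (ℤ.+-inverseˡ a) (ℤ.+-inverseˡ b) })
                    , (λ { (a , b) → cong₂ _,_ (ℤ.+-inverseʳ a) (ℤ.+-inverseʳ b) })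
          ; ⁻¹-cong = ≡.cong -ᵍ_ }
        ; comm = λ { (a , b) (c , d) → cong₂ _,_ (ℤ.+-comm a c) (ℤ.+-comm b d) } }
      ; *-cong = cong₂ _*ᵍ_
      ; *-assoc = λ { (a , b) (c , d) (e , f) → cong₂ _,_ (*-assoc-re a b c d e f) (*-assoc-im a b c d e f) }
      ; *-identity = (λ { (c , d) → cong₂ _,_ (*-identityˡ-re c d) (*-identityˡ-im c d) })
                   , (λ { (c , d) → cong₂ _,_ (*-identityʳ-re c d) (*-identityʳ-im c d) })
      ; distrib = (λ { (a , b) (c , d) (e , f) → cong₂ _,_ (distribˡ-re a b c d e f) (distribˡ-im a b c d e f) })
                , (λ { (a , b) (c , d) (e , f) → cong₂ _,_ (distribʳ-re a b c d e f) (distribʳ-im a b c d e f) }) }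
    ; *-comm = λ { (a , b) (c , d) → cong₂ _,_ (*-comm-re a b c d) (*-comm-im a b c d) } }

  ℤ[i] : StarCRing
  ℤ[i] = record
    { scalars = record { isCommutativeRing = isCommutativeRing }
    ; conj = conjᵍ
    ; conj-cong = ≡.cong conjᵍ
    ; conj-+ = λ { (a , b) (c , d) → cong₂ _,_ ≡.refl (ℤ.neg-distrib-+ b d) }
    ; conj-* = λ { (a , b) (c , d) → cong₂ _,_ (conj-*-re a b c d) (conj-*-im a b c d) }
    ; conj-1 = ≡.refl
    ; conj-invol = λ { (a , b) → cong₂ _,_ ≡.refl (ℤ.neg-involutive b) }
    ; ι = + 0 , + 1
    ; ι² = ≡.refl
    ; conj-ι = ≡.refl }

module GaussianEmbedding (R : StarCRing) where

  open import Data.Integer using (+_; -[1+_])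
  open GaussianIntegers
  open StarCRing R
  open QuaternionSums R
  open IntegerCoefficients scalars using (⟦_⟧; ⟦⟧-+; ⟦⟧-*; ⟦⟧-neg; solve; _:=_; _:+_; _:*_; _:-_; :-_; :0; :1)
  open import Algebra.Properties.Semiring.Mult.TCOptimised semiring using (_×_; 1+×)
  open import Data.Product using (_,_)
  open import Relation.Binary.Reasoning.Setoid setoid
  module ℍᶻ = QuaternionAlgebra ℤ[i]

  φ : ℤ² → Carrier
  φ (x , y) = ⟦ x ⟧ + ⟦ y ⟧ * ι

  conj-×1 : ∀ k → conj (k × 1#) ≈ k × 1#
  conj-×1 zero = conj-0
  conj-×1 (suc k) = begin
    conj (suc k × 1#)        ≈⟨ conj-cong (1+× k 1#) ⟩
    conj (1# + k × 1#)       ≈⟨ conj-+ 1# (k × 1#) ⟩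
    conj 1# + conj (k × 1#)  ≈⟨ +-cong conj-1 (conj-×1 k) ⟩
    1# + k × 1#              ≈⟨ 1+× k 1# ⟨
    suc k × 1#               ∎

  conj-⟦⟧ : ∀ i → conj ⟦ i ⟧ ≈ ⟦ i ⟧
  conj-⟦⟧ (+ k) = conj-×1 k
  conj-⟦⟧ -[1+ k ] = trans (conj-neg _) (-‿cong (conj-×1 (suc k)))

  φ-+ : ∀ p q → φ (p +ᵍ q) ≈ φ p + φ q
  φ-+ (x , y) (x′ , y′) = begin
    ⟦ x ℤ.+ x′ ⟧ + ⟦ y ℤ.+ y′ ⟧ * ι              ≈⟨ +-cong (⟦⟧-+ x x′) (*-congʳ (⟦⟧-+ y y′)) ⟩
    (⟦ x ⟧ + ⟦ x′ ⟧) + (⟦ y ⟧ + ⟦ y′ ⟧) * ι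
      ≈⟨ solve 5 (λ a b c d i → (a :+ b) :+ (c :+ d) :* i := (a :+ c :* i) :+ (b :+ d :* i)) refl ⟦ x ⟧ ⟦ x′ ⟧ ⟦ y ⟧ ⟦ y′ ⟧ ι ⟩
    (⟦ x ⟧ + ⟦ y ⟧ * ι) + (⟦ x′ ⟧ + ⟦ y′ ⟧ * ι)  ∎

  φ-neg : ∀ p → φ (-ᵍ p) ≈ - φ p
  φ-neg (x , y) = begin
    ⟦ ℤ.- x ⟧ + ⟦ ℤ.- y ⟧ * ι  ≈⟨ +-cong (⟦⟧-neg x) (*-congʳ (⟦⟧-neg y)) ⟩
    - ⟦ x ⟧ + - ⟦ y ⟧ * ι      ≈⟨ solve 3 (λ a b i → :- a :+ :- b :* i := :- (a :+ b :* i)) refl ⟦ x ⟧ ⟦ y ⟧ ι ⟩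
    - (⟦ x ⟧ + ⟦ y ⟧ * ι)      ∎

  ⟦⟧-- : ∀ i j → ⟦ i ℤ.- j ⟧ ≈ ⟦ i ⟧ - ⟦ j ⟧
  ⟦⟧-- i j = trans (⟦⟧-+ i (ℤ.- j)) (+-congˡ (⟦⟧-neg j))

  φ-* : ∀ p q → φ (p *ᵍ q) ≈ φ p * φ q
  φ-* (a , b) (c , d) = begin
    ⟦ a ℤ.* c ℤ.- b ℤ.* d ⟧ + ⟦ a ℤ.* d ℤ.+ b ℤ.* c ⟧ * ι
      ≈⟨ +-cong (trans (⟦⟧-- (a ℤ.* c) (b ℤ.* d)) (+-cong (⟦⟧-* a c) (-‿cong (⟦⟧-* b d))))
                (*-congʳ (trans (⟦⟧-+ (a ℤ.* d) (b ℤ.* c)) (+-cong (⟦⟧-* a d) (⟦⟧-* b c)))) ⟩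
    (A * C - B * D) + (A * D + B * C) * ι
      ≈⟨ solve 5 (λ A B C D i → (A :* C :- B :* D) :+ (A :* D :+ B :* C) :* i
                   := (A :+ B :* i) :* (C :+ D :* i) :- B :* D :* (i :* i :+ :1)) refl A B C D ι ⟩
    (A + B * ι) * (C + D * ι) - B * D * (ι * ι + 1#)
      ≈⟨ +-congˡ (-‿cong (*-congˡ (trans (+-congʳ ι²) (-‿inverseˡ 1#)))) ⟩
    (A + B * ι) * (C + D * ι) - B * D * 0#
      ≈⟨ solve 2 (λ P Q → P :- Q :* :0 := P) refl ((A + B * ι) * (C + D * ι)) (B * D) ⟩
    (A + B * ι) * (C + D * ι) ∎
    where A = ⟦ a ⟧; B = ⟦ b ⟧; C = ⟦ c ⟧; D = ⟦ d ⟧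

  φ-conj : ∀ p → φ (conjᵍ p) ≈ conj (φ p)
  φ-conj (x , y) = begin
    ⟦ x ⟧ + ⟦ ℤ.- y ⟧ * ι            ≈⟨ +-congˡ (*-congʳ (⟦⟧-neg y)) ⟩
    ⟦ x ⟧ + - ⟦ y ⟧ * ι              ≈⟨ solve 3 (λ a b i → a :+ :- b :* i := a :+ b :* (:- i)) refl ⟦ x ⟧ ⟦ y ⟧ ι ⟩
    ⟦ x ⟧ + ⟦ y ⟧ * - ι              ≈⟨ +-cong (conj-⟦⟧ x) (*-cong (conj-⟦⟧ y) conj-ι) ⟨
    conj ⟦ x ⟧ + conj ⟦ y ⟧ * conj ι  ≈⟨ +-congˡ (conj-* _ _) ⟨
    conj ⟦ x ⟧ + conj (⟦ y ⟧ * ι)    ≈⟨ conj-+ _ _ ⟨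
    conj (⟦ x ⟧ + ⟦ y ⟧ * ι)         ∎

  φ̂ : ℍᶻ.ℍ → ℍ
  φ̂ (a ℍᶻ.+ⱼ b) = φ a +ⱼ φ b

  φ̂-cong : ∀ {p q} → p ≡ q → φ̂ p ≈ℍ φ̂ q
  φ̂-cong ≡.refl = ≈ℍ-refl

  φ̂-+ : ∀ p q → φ̂ (p ℍᶻ.+ℍ q) ≈ℍ (φ̂ p +ℍ φ̂ q)
  φ̂-+ (a ℍᶻ.+ⱼ b) (c ℍᶻ.+ⱼ d) = φ-+ a c , φ-+ b d

  φ̂-neg : ∀ p → φ̂ (ℍᶻ.-ℍ p) ≈ℍ (-ℍ φ̂ p)
  φ̂-neg (a ℍᶻ.+ⱼ b) = φ-neg a , φ-neg b

  φ̂-ℍ* : ∀ p → φ̂ (p ℍᶻ.ℍ*) ≈ℍ (φ̂ p ℍ*)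
  φ̂-ℍ* (a ℍᶻ.+ⱼ b) = φ-conj a , φ-neg b

  φ̂-* : ∀ p q → φ̂ (p ℍᶻ.*ℍ q) ≈ℍ (φ̂ p *ℍ φ̂ q)
  φ̂-* (a ℍᶻ.+ⱼ b) (c ℍᶻ.+ⱼ d) =
    trans (φ-+ (a *ᵍ c) (-ᵍ (b *ᵍ conjᵍ d)))
          (+-cong (φ-* a c) (trans (φ-neg (b *ᵍ conjᵍ d)) (-‿cong (trans (φ-* b (conjᵍ d)) (*-congˡ (φ-conj d)))))) ,
    trans (φ-+ (a *ᵍ d) (b *ᵍ conjᵍ c)) (+-cong (φ-* a d) (trans (φ-* b (conjᵍ c)) (*-congˡ (φ-conj c))))

  φ-0 : φ (+ 0 , + 0) ≈ 0#
  φ-0 = solve 1 (λ i → :0 :+ :0 :* i := :0) refl ι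

  φ-1 : φ (+ 1 , + 0) ≈ 1#
  φ-1 = solve 1 (λ i → :1 :+ :0 :* i := :1) refl ι

  φ̂-0 : φ̂ ℍᶻ.0ℍ ≈ℍ 0ℍ
  φ̂-0 = φ-0 , φ-0

  φ̂-1 : φ̂ ℍᶻ.1ℍ ≈ℍ 1ℍ
  φ̂-1 = φ-1 , φ-0

  φ-ι : φ (+ 0 , + 1) ≈ ι
  φ-ι = solve 1 (λ i → :0 :+ :1 :* i := i) refl ι

  φ̂-evalU : ∀ e → φ̂ (ℍᶻ.evalU e) ≈ℍ evalU e
  φ̂-evalU 𝟙 = φ̂-1
  φ̂-evalU 𝕚 = φ-ι , φ-0
  φ̂-evalU 𝕛 = φ-0 , φ-1
  φ̂-evalU 𝕜 = φ-0 , φ-ι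

  φ̂-evalSU : ∀ u → φ̂ (ℍᶻ.evalSU u) ≈ℍ evalSU u
  φ̂-evalSU (su false e) = φ̂-evalU e
  φ̂-evalSU (su true e) = ≈ℍ-trans (φ̂-neg (ℍᶻ.evalU e)) (-ℍ-cong (φ̂-evalU e))

  φ̂-sum : ∀ k f → φ̂ (ℍᶻ.sumℍ k f) ≈ℍ sumℍ k (λ i → φ̂ (f i))
  φ̂-sum zero f = φ̂-0
  φ̂-sum (suc k) f = ≈ℍ-trans (φ̂-+ (ℍᶻ.sumℍ k f) (f k)) (+ℍ-cong (φ̂-sum k f) ≈ℍ-refl)

module SignedUnits (R : StarCRing) where

  open QuaternionSums R public
  open GaussianEmbedding R

  negIf : Bool → ℍ → ℍ
  negIf b p = if b then -ℍ p else p

  negIf-cong : ∀ b {p q} → p ≈ℍ q → negIf b p ≈ℍ negIf b q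
  negIf-cong true p≈q = -ℍ-cong p≈q
  negIf-cong false p≈q = p≈q

  negIf-≡ : ∀ {b c} p → b ≡ c → negIf b p ≈ℍ negIf c p
  negIf-≡ p ≡.refl = ≈ℍ-refl

  negIf-not : ∀ b p → negIf (not b) p ≈ℍ (-ℍ negIf b p)
  negIf-not true p = ≈ℍ-sym (-ℍ-involutive p)
  negIf-not false p = ≈ℍ-refl

  negIf-xor : ∀ a b p → negIf (a xor b) p ≈ℍ negIf a (negIf b p)
  negIf-xor true b p = negIf-not b p
  negIf-xor false b p = ≈ℍ-refl

  negIf-* : ∀ a b p q → (negIf a p *ℍ negIf b q) ≈ℍ negIf (a xor b) (p *ℍ q)
  negIf-* false false p q = ≈ℍ-refl
  negIf-* false true p q = *ℍ-negʳ p q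
  negIf-* true false p q = *ℍ-negˡ p q
  negIf-* true true p q = ≈ℍ-trans (*ℍ-negˡ p (-ℍ q)) (≈ℍ-trans (-ℍ-cong (*ℍ-negʳ p q)) (-ℍ-involutive _))

  negIf-ℍ* : ∀ b p → (negIf b p ℍ*) ≈ℍ negIf b (p ℍ*)
  negIf-ℍ* true p = ℍ*-neg p
  negIf-ℍ* false p = ≈ℍ-refl

  negIf-0 : ∀ b → negIf b 0ℍ ≈ℍ 0ℍ
  negIf-0 true = -ℍ-0
  negIf-0 false = ≈ℍ-refl

  negIf-cancel : ∀ b p → (negIf b p +ℍ negIf (not b) p) ≈ℍ 0ℍ
  negIf-cancel true p = -ℍ-inverseˡ p
  negIf-cancel false p = -ℍ-inverseʳ p

  sum-negIf : ∀ b k f → sumℍ k (λ i → negIf b (f i)) ≈ℍ negIf b (sumℍ k f)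
  sum-negIf true k f = sum-neg k f
  sum-negIf false k f = ≈ℍ-refl

  -- Identities between signed units are computed in ℤ[i] and transported along φ̂.
  private
    evalU-mulᶻ : ∀ e f → (ℍᶻ.evalU e ℍᶻ.*ℍ ℍᶻ.evalU f) ≡ ℍᶻ.evalSU (unitMul e f)
    evalU-mulᶻ 𝟙 𝟙 = ≡.refl
    evalU-mulᶻ 𝟙 𝕚 = ≡.refl
    evalU-mulᶻ 𝟙 𝕛 = ≡.refl
    evalU-mulᶻ 𝟙 𝕜 = ≡.refl
    evalU-mulᶻ 𝕚 𝟙 = ≡.refl
    evalU-mulᶻ 𝕚 𝕚 = ≡.refl
    evalU-mulᶻ 𝕚 𝕛 = ≡.refl
    evalU-mulᶻ 𝕚 𝕜 = ≡.refl
    evalU-mulᶻ 𝕛 𝟙 = ≡.refl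
    evalU-mulᶻ 𝕛 𝕚 = ≡.refl
    evalU-mulᶻ 𝕛 𝕛 = ≡.refl
    evalU-mulᶻ 𝕛 𝕜 = ≡.refl
    evalU-mulᶻ 𝕜 𝟙 = ≡.refl
    evalU-mulᶻ 𝕜 𝕚 = ≡.refl
    evalU-mulᶻ 𝕜 𝕛 = ≡.refl
    evalU-mulᶻ 𝕜 𝕜 = ≡.refl

    evalSU-conjᶻ : ∀ u → ℍᶻ.evalSU (conjSU u) ≡ (ℍᶻ.evalSU u ℍᶻ.ℍ*)
    evalSU-conjᶻ (su false 𝟙) = ≡.refl
    evalSU-conjᶻ (su false 𝕚) = ≡.refl
    evalSU-conjᶻ (su false 𝕛) = ≡.refl
    evalSU-conjᶻ (su false 𝕜) = ≡.refl
    evalSU-conjᶻ (su true 𝟙) = ≡.refl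
    evalSU-conjᶻ (su true 𝕚) = ≡.refl
    evalSU-conjᶻ (su true 𝕛) = ≡.refl
    evalSU-conjᶻ (su true 𝕜) = ≡.refl

  evalSU-neg : ∀ u → evalSU (negSU u) ≈ℍ (-ℍ evalSU u)
  evalSU-neg (su b e) = negIf-not b (evalU e)

  evalU-mul : ∀ e f → (evalU e *ℍ evalU f) ≈ℍ evalSU (unitMul e f)
  evalU-mul e f = begin
    evalU e *ℍ evalU f                             ≈⟨ *ℍ-cong (φ̂-evalU e) (φ̂-evalU f) ⟨
    φ̂ (ℍᶻ.evalU e) *ℍ φ̂ (ℍᶻ.evalU f)              ≈⟨ φ̂-* (ℍᶻ.evalU e) (ℍᶻ.evalU f) ⟨
    φ̂ (ℍᶻ.evalU e ℍᶻ.*ℍ ℍᶻ.evalU f)               ≈⟨ φ̂-cong (evalU-mulᶻ e f) ⟩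
    φ̂ (ℍᶻ.evalSU (unitMul e f))                   ≈⟨ φ̂-evalSU (unitMul e f) ⟩
    evalSU (unitMul e f)                          ∎
    where open ℍ-Reasoning

  evalSU-mul : ∀ u v → evalSU (mulSU u v) ≈ℍ (evalSU u *ℍ evalSU v)
  evalSU-mul (su a e) (su b f) = begin
    negIf (a xor b xor SUnit.neg w) (evalU (SUnit.unit w))  ≈⟨ negIf-xor a _ _ ⟩
    negIf a (negIf (b xor SUnit.neg w) (evalU (SUnit.unit w)))  ≈⟨ negIf-cong a (negIf-xor b _ _) ⟩
    negIf a (negIf b (evalSU w))                            ≈⟨ negIf-xor a b _ ⟨
    negIf (a xor b) (evalSU w)                              ≈⟨ negIf-cong (a xor b) (evalU-mul e f) ⟨
    negIf (a xor b) (evalU e *ℍ evalU f)                    ≈⟨ negIf-* a b _ _ ⟨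
    negIf a (evalU e) *ℍ negIf b (evalU f)                  ∎
    where open ℍ-Reasoning
          w = unitMul e f

  evalSU-conj : ∀ u → evalSU (conjSU u) ≈ℍ (evalSU u ℍ*)
  evalSU-conj u = begin
    evalSU (conjSU u)            ≈⟨ φ̂-evalSU (conjSU u) ⟨
    φ̂ (ℍᶻ.evalSU (conjSU u))     ≈⟨ φ̂-cong (evalSU-conjᶻ u) ⟩
    φ̂ (ℍᶻ.evalSU u ℍᶻ.ℍ*)        ≈⟨ φ̂-ℍ* (ℍᶻ.evalSU u) ⟩
    φ̂ (ℍᶻ.evalSU u) ℍ*           ≈⟨ ℍ*-cong (φ̂-evalSU u) ⟩
    evalSU u ℍ*                  ∎
    where open ℍ-Reasoning

  conjSU-product : ∀ u v → (evalSU (conjSU u) *ℍ (evalSU (conjSU v) ℍ*)) ≈ℍ ((evalSU u ℍ*) *ℍ evalSU v)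
  conjSU-product u v = *ℍ-cong (evalSU-conj u) (≈ℍ-trans (ℍ*-cong (evalSU-conj v)) (ℍ*-involutive _))

  evalSU-negIf : ∀ s u → evalSU (if s then negSU u else u) ≈ℍ negIf s (evalSU u)
  evalSU-negIf true u = evalSU-neg u
  evalSU-negIf false u = ≈ℍ-refl

  conjSU-mul-self : ∀ u → mulSU (conjSU u) u ≡ su false 𝟙
  conjSU-mul-self (su false 𝟙) = ≡.refl
  conjSU-mul-self (su false 𝕚) = ≡.refl
  conjSU-mul-self (su false 𝕛) = ≡.refl
  conjSU-mul-self (su false 𝕜) = ≡.refl
  conjSU-mul-self (su true 𝟙) = ≡.refl
  conjSU-mul-self (su true 𝕚) = ≡.refl
  conjSU-mul-self (su true 𝕛) = ≡.refl
  conjSU-mul-self (su true 𝕜) = ≡.refl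

  evalSU-norm : ∀ u → ((evalSU u ℍ*) *ℍ evalSU u) ≈ℍ 1ℍ
  evalSU-norm u = begin
    (evalSU u ℍ*) *ℍ evalSU u      ≈⟨ *ℍ-cong (evalSU-conj u) ≈ℍ-refl ⟨
    evalSU (conjSU u) *ℍ evalSU u  ≈⟨ evalSU-mul (conjSU u) u ⟨
    evalSU (mulSU (conjSU u) u)    ≈⟨ ≈ℍ-reflexive (≡.cong evalSU (conjSU-mul-self u)) ⟩
    1ℍ                             ∎
    where open ℍ-Reasoning

  evalE-lmul : ∀ {u} (x : Fin u → StarCRing.Carrier R) t e → evalE x (lmulE t e) ≈ℍ (evalSU t *ℍ evalE x e)
  evalE-lmul x t 0ₑ = ≈ℍ-sym (*ℍ-zeroʳ _)
  evalE-lmul x t (term s ℓ c) = ≈ℍ-trans (*ℍ-cong (evalSU-mul t s) ≈ℍ-refl) (*ℍ-assoc _ _ _)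

  evalE-neg : ∀ {u} (x : Fin u → StarCRing.Carrier R) e → evalE x (negE e) ≈ℍ (-ℍ evalE x e)
  evalE-neg x 0ₑ = ≈ℍ-sym -ℍ-0
  evalE-neg x (term s ℓ c) = ≈ℍ-trans (*ℍ-cong (evalSU-neg s) ≈ℍ-refl) (*ℍ-negˡ _ _)

module ColumnProducts (R : StarCRing) (n : ℕ) (H : HMat) where

  open SignedUnits R
  open import Data.Nat using (_<_; _≡ᵇ_)

  h : ℕ → ℕ → ℍ
  h c a = evalSU (H c a)

  colProd : ℕ → ℕ → ℍ
  colProd a b = sumℍ n (λ c → (h c a ℍ*) *ℍ h c b)

  colProd-diag : ∀ a → colProd a a ≈ℍ natℍ n
  colProd-diag a = ≈ℍ-trans (sum-cong n (λ c _ → evalSU-norm (H c a))) (sum-ones n)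

  module _ (rows : IsOrth n h (natℍ n)) where

    private
      N = natℍ n

      summand : ℕ → ℕ → ℕ → ℕ → ℍ
      summand a b c d = (h c a ℍ*) *ℍ ((h c b *ℍ (h d b ℍ*)) *ℍ h d a)

    colProd-norm : ∀ a b → (colProd a b *ℍ (colProd a b ℍ*)) ≈ℍ sumℍ n (λ c → sumℍ n (summand a b c))
    colProd-norm a b = begin
      colProd a b *ℍ (colProd a b ℍ*)
        ≈⟨ *ℍ-cong ≈ℍ-refl (sum-ℍ* n _) ⟩
      colProd a b *ℍ sumℍ n (λ d → ((h d a ℍ*) *ℍ h d b) ℍ*)
        ≈⟨ sum-*ʳ n _ _ ⟩
      sumℍ n (λ c → ((h c a ℍ*) *ℍ h c b) *ℍ sumℍ n (λ d → ((h d a ℍ*) *ℍ h d b) ℍ*))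
        ≈⟨ sum-cong n (λ c _ → ≈ℍ-trans (sum-*ˡ n _ _) (sum-cong n (λ d _ → regroup c d))) ⟩
      sumℍ n (λ c → sumℍ n (summand a b c)) ∎
      where
      open ℍ-Reasoning
      regroup : ∀ c d → (((h c a ℍ*) *ℍ h c b) *ℍ (((h d a ℍ*) *ℍ h d b) ℍ*)) ≈ℍ summand a b c d
      regroup c d = begin
        ((h c a ℍ*) *ℍ h c b) *ℍ (((h d a ℍ*) *ℍ h d b) ℍ*)      ≈⟨ *ℍ-cong ≈ℍ-refl (ℍ*-anti-* _ _) ⟩
        ((h c a ℍ*) *ℍ h c b) *ℍ ((h d b ℍ*) *ℍ ((h d a ℍ*) ℍ*)) ≈⟨ *ℍ-cong ≈ℍ-refl (*ℍ-cong ≈ℍ-refl (ℍ*-involutive _)) ⟩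
        ((h c a ℍ*) *ℍ h c b) *ℍ ((h d b ℍ*) *ℍ h d a)           ≈⟨ *ℍ-assoc _ _ _ ⟩
        (h c a ℍ*) *ℍ (h c b *ℍ ((h d b ℍ*) *ℍ h d a))           ≈⟨ *ℍ-cong ≈ℍ-refl (*ℍ-assoc _ _ _) ⟨
        summand a b c d                                             ∎

    row-collapse : ∀ a c → c < n → sumℍ n (λ d → sumℍ n (λ b → summand a b c d)) ≈ℍ N
    row-collapse a c c<n = begin
      sumℍ n (λ d → sumℍ n (λ b → summand a b c d))
        ≈⟨ sum-cong n (λ d d<n → factor d d<n) ⟩
      sumℍ n (λ d → if c ≡ᵇ d then (h c a ℍ*) *ℍ (N *ℍ h d a) else 0ℍ)
        ≈⟨ sum-δ n c (λ d → (h c a ℍ*) *ℍ (N *ℍ h d a)) c<n ⟩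
      (h c a ℍ*) *ℍ (N *ℍ h c a)  ≈⟨ *ℍ-cong ≈ℍ-refl (natℍ-central n _) ⟩
      (h c a ℍ*) *ℍ (h c a *ℍ N)  ≈⟨ *ℍ-assoc _ _ _ ⟨
      ((h c a ℍ*) *ℍ h c a) *ℍ N  ≈⟨ *ℍ-cong (evalSU-norm (H c a)) ≈ℍ-refl ⟩
      1ℍ *ℍ N                     ≈⟨ *ℍ-identityˡ N ⟩
      N                           ∎
      where
      open ℍ-Reasoning
      factor : ∀ d → d < n → sumℍ n (λ b → summand a b c d) ≈ℍ (if c ≡ᵇ d then (h c a ℍ*) *ℍ (N *ℍ h d a) else 0ℍ)
      factor d d<n = begin
        sumℍ n (λ b → summand a b c d)                                   ≈⟨ sum-*ˡ n _ _ ⟨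
        (h c a ℍ*) *ℍ sumℍ n (λ b → (h c b *ℍ (h d b ℍ*)) *ℍ h d a)  ≈⟨ *ℍ-cong ≈ℍ-refl (sum-*ʳ n _ _) ⟨
        (h c a ℍ*) *ℍ (sumℍ n (λ b → h c b *ℍ (h d b ℍ*)) *ℍ h d a)  ≈⟨ *ℍ-cong ≈ℍ-refl (*ℍ-cong (rows c d c<n d<n) ≈ℍ-refl) ⟩
        (h c a ℍ*) *ℍ ((if c ≡ᵇ d then N else 0ℍ) *ℍ h d a)         ≈⟨ *ℍ-cong ≈ℍ-refl (if-*ʳ (c ≡ᵇ d) N _) ⟩
        (h c a ℍ*) *ℍ (if c ≡ᵇ d then N *ℍ h d a else 0ℍ)            ≈⟨ if-*ˡ (c ≡ᵇ d) _ _ ⟩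
        (if c ≡ᵇ d then (h c a ℍ*) *ℍ (N *ℍ h d a) else 0ℍ)         ∎

    colProd-normSum : ∀ a → sumℍ n (λ b → colProd a b *ℍ (colProd a b ℍ*)) ≈ℍ (N *ℍ N)
    colProd-normSum a = begin
      sumℍ n (λ b → colProd a b *ℍ (colProd a b ℍ*))         ≈⟨ sum-cong n (λ b _ → colProd-norm a b) ⟩
      sumℍ n (λ b → sumℍ n (λ c → sumℍ n (summand a b c)))      ≈⟨ sum-comm n n _ ⟩
      sumℍ n (λ c → sumℍ n (λ b → sumℍ n (summand a b c)))      ≈⟨ sum-cong n (λ c _ → sum-comm n n _) ⟩
      sumℍ n (λ c → sumℍ n (λ d → sumℍ n (λ b → summand a b c d))) ≈⟨ sum-cong n (row-collapse a) ⟩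
      sumℍ n (λ _ → N)                                       ≈⟨ sum-const n N ⟩
      N *ℍ N                                                 ∎
      where open ℍ-Reasoning

module GaussianColumns where

  open import Data.Integer using (+_; -[1+_])
  open GaussianIntegers
  open SignedUnits ℤ[i]
  open import Data.Integer.Tactic.RingSolver using (solve-∀)
  open import Data.Nat using (_<_; _≤_; _+_; _*_)
  open import Data.Product using (_,_; proj₁)
  open import Data.Sum using (reduce)
  open import Data.Empty using (⊥-elim)
  open ≡ using (cong₂)

  sq : ℤ → ℕ
  sq x = ℤ.∣ x ∣ * ℤ.∣ x ∣

  *-self≡sq : ∀ x → x ℤ.* x ≡ + sq x
  *-self≡sq (+ k) = ℤ.+◃n≡+n (k * k)
  *-self≡sq -[1+ k ] = ℤ.+◃n≡+n _

  sq≡0 : ∀ x → sq x ≡ 0 → x ≡ + 0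
  sq≡0 x eq = reduce (ℤ.i*j≡0⇒i≡0∨j≡0 x (≡.trans (*-self≡sq x) (≡.cong +_ eq)))

  ‖_‖ : ℍ → ℕ
  ‖ (x , y) +ⱼ (z , w) ‖ = sq x + sq y + sq z + sq w

  reℤ : ℍ → ℤ
  reℤ q = proj₁ (ℍ.re q)

  reℤ-norm : ∀ q → reℤ (q *ℍ (q ℍ*)) ≡ + ‖ q ‖
  reℤ-norm ((x , y) +ⱼ (z , w)) = begin
    x ℤ.* x ℤ.- y ℤ.* ℤ.- y ℤ.- (z ℤ.* ℤ.- z ℤ.- w ℤ.* ℤ.- ℤ.- w)  ≡⟨ expand x y z w ⟩
    x ℤ.* x ℤ.+ y ℤ.* y ℤ.+ z ℤ.* z ℤ.+ w ℤ.* w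
      ≡⟨ cong₂ ℤ._+_ (cong₂ ℤ._+_ (cong₂ ℤ._+_ (*-self≡sq x) (*-self≡sq y)) (*-self≡sq z)) (*-self≡sq w) ⟩
    + sq x ℤ.+ + sq y ℤ.+ + sq z ℤ.+ + sq w
      ≡⟨ ≡.cong (ℤ._+ + sq w) (≡.cong (ℤ._+ + sq z) (ℤ.pos-+ (sq x) (sq y))) ⟨
    + (sq x + sq y) ℤ.+ + sq z ℤ.+ + sq w                           ≡⟨ ≡.cong (ℤ._+ + sq w) (ℤ.pos-+ (sq x + sq y) (sq z)) ⟨
    + (sq x + sq y + sq z) ℤ.+ + sq w                               ≡⟨ ℤ.pos-+ (sq x + sq y + sq z) (sq w) ⟨
    + ‖ (x , y) +ⱼ (z , w) ‖                                        ∎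
    where
    open ≡.≡-Reasoning
    expand : ∀ x y z w → x ℤ.* x ℤ.- y ℤ.* ℤ.- y ℤ.- (z ℤ.* ℤ.- z ℤ.- w ℤ.* ℤ.- ℤ.- w)
                         ≡ x ℤ.* x ℤ.+ y ℤ.* y ℤ.+ z ℤ.* z ℤ.+ w ℤ.* w
    expand = solve-∀

  ‖‖≡0 : ∀ q → ‖ q ‖ ≡ 0 → q ≡ 0ℍ
  ‖‖≡0 ((x , y) +ⱼ (z , w)) eq =
    cong₂ _+ⱼ_ (cong₂ _,_ (sq≡0 x (ℕ.m+n≡0⇒m≡0 _ xy≡0)) (sq≡0 y (ℕ.m+n≡0⇒n≡0 (sq x) xy≡0)))
               (cong₂ _,_ (sq≡0 z (ℕ.m+n≡0⇒n≡0 (sq x + sq y) xyz≡0)) (sq≡0 w (ℕ.m+n≡0⇒n≡0 (sq x + sq y + sq z) eq)))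
    where
    xyz≡0 = ℕ.m+n≡0⇒m≡0 _ eq
    xy≡0 = ℕ.m+n≡0⇒m≡0 _ xyz≡0

  Σℕ : ℕ → (ℕ → ℕ) → ℕ
  Σℕ zero g = 0
  Σℕ (suc k) g = Σℕ k g + g k

  reℤ-sumNorms : ∀ k (f : ℕ → ℍ) → reℤ (sumℍ k (λ i → f i *ℍ (f i ℍ*))) ≡ + Σℕ k (λ i → ‖ f i ‖)
  reℤ-sumNorms zero f = ≡.refl
  reℤ-sumNorms (suc k) f =
    ≡.trans (cong₂ ℤ._+_ (reℤ-sumNorms k f) (reℤ-norm (f k))) (≡.sym (ℤ.pos-+ (Σℕ k (λ i → ‖ f i ‖)) ‖ f k ‖))

  ≤-Σℕ : ∀ k g {b} → b < k → g b ≤ Σℕ k g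
  ≤-Σℕ (suc k) g {b} b<1+k with b ℕ.≟ k
  ... | yes ≡.refl = ℕ.m≤n+m (g b) (Σℕ k g)
  ... | no b≢k = ℕ.≤-trans (≤-Σℕ k g (ℕ.≤∧≢⇒< (ℕ.≤-pred b<1+k) b≢k)) (ℕ.m≤m+n _ _)

  +-≤-Σℕ : ∀ k g {a b} → a < k → b < k → a ≢ b → g a + g b ≤ Σℕ k g
  +-≤-Σℕ (suc k) g {a} {b} a<1+k b<1+k a≢b with a ℕ.≟ k | b ℕ.≟ k
  ... | yes ≡.refl | yes ≡.refl = ⊥-elim (a≢b ≡.refl)
  ... | yes ≡.refl | no b≢k = ≡.subst (_≤ Σℕ k g + g a) (ℕ.+-comm (g b) (g a))
                                 (ℕ.+-monoˡ-≤ (g a) (≤-Σℕ k g (ℕ.≤∧≢⇒< (ℕ.≤-pred b<1+k) b≢k)))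
  ... | no a≢k | yes ≡.refl = ℕ.+-monoˡ-≤ (g b) (≤-Σℕ k g (ℕ.≤∧≢⇒< (ℕ.≤-pred a<1+k) a≢k))
  ... | no a≢k | no b≢k = ℕ.≤-trans (+-≤-Σℕ k g (ℕ.≤∧≢⇒< (ℕ.≤-pred a<1+k) a≢k) (ℕ.≤∧≢⇒< (ℕ.≤-pred b<1+k) b≢k) a≢b)
                                    (ℕ.m≤m+n _ _)

  natMul-1≡ : ∀ k → natMul k (+ 1 , + 0) ≡ (+ k , + 0)
  natMul-1≡ zero = ≡.refl
  natMul-1≡ (suc k) rewrite natMul-1≡ k = ≡.refl

  ‖natℍ‖ : ∀ k → ‖ natℍ k ‖ ≡ k * k
  ‖natℍ‖ k rewrite natMul-1≡ k = ≡.trans (ℕ.+-identityʳ _) (≡.trans (ℕ.+-identityʳ _) (ℕ.+-identityʳ _))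

  reℤ-natℍ² : ∀ k → reℤ (natℍ k *ℍ natℍ k) ≡ + (k * k)
  reℤ-natℍ² k = ≡.trans (≡.cong reℤ (ℍ*-natℍ-square k)) (≡.trans (reℤ-norm (natℍ k)) (≡.cong +_ (‖natℍ‖ k)))
    where
    ℍ*-natℍ-square : ∀ k → natℍ k *ℍ natℍ k ≡ natℍ k *ℍ (natℍ k ℍ*)
    ℍ*-natℍ-square k rewrite natMul-1≡ k = ≡.refl

  module _ (n : ℕ) (H : HMat) (rows : IsOrth n (λ a b → evalSU (H a b)) (natℍ n)) where

    open ColumnProducts ℤ[i] n H

    ≈ℍ⇒≡ : ∀ {p q} → p ≈ℍ q → p ≡ q
    ≈ℍ⇒≡ (e₁ , e₂) = cong₂ _+ⱼ_ e₁ e₂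

    Σ‖colProd‖ : ∀ a → Σℕ n (λ b → ‖ colProd a b ‖) ≡ n * n
    Σ‖colProd‖ a = ℤ.+-injective (begin
      + Σℕ n (λ b → ‖ colProd a b ‖)                   ≡⟨ reℤ-sumNorms n (colProd a) ⟨
      reℤ (sumℍ n (λ b → colProd a b *ℍ (colProd a b ℍ*)))  ≡⟨ ≡.cong reℤ (≈ℍ⇒≡ (colProd-normSum rows a)) ⟩
      reℤ (natℍ n *ℍ natℍ n)                            ≡⟨ reℤ-natℍ² n ⟩
      + (n * n)                                         ∎)
      where open ≡.≡-Reasoning

    colProd-offDiagonal : ∀ {a b} → a < n → b < n → a ≢ b → colProd a b ≡ 0ℍ
    colProd-offDiagonal {a} {b} a<n b<n a≢b = ‖‖≡0 (colProd a b) (ℕ.n≤0⇒n≡0 (ℕ.+-cancelˡ-≤ ‖ colProd a a ‖ _ _ bound))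
      where
      bound : ‖ colProd a a ‖ + ‖ colProd a b ‖ ≤ ‖ colProd a a ‖ + 0
      bound = begin
        ‖ colProd a a ‖ + ‖ colProd a b ‖  ≤⟨ +-≤-Σℕ n (λ b → ‖ colProd a b ‖) a<n b<n a≢b ⟩
        Σℕ n (λ b → ‖ colProd a b ‖)      ≡⟨ Σ‖colProd‖ a ⟩
        n * n                              ≡⟨ ≡.trans (≡.cong ‖_‖ (≈ℍ⇒≡ (colProd-diag a))) (‖natℍ‖ n) ⟨
        ‖ colProd a a ‖                    ≡⟨ ℕ.+-identityʳ _ ⟨
        ‖ colProd a a ‖ + 0                ∎
        where open ℕ.≤-Reasoning

module ColumnOrthogonality (n : ℕ) (H : HMat) (hadamard : IsQHadamard n H) (R : StarCRing) where

  open SignedUnits R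
  open GaussianEmbedding R
  open ColumnProducts R n H using (colProd; colProd-diag)
  open import Data.Nat using (_<_; _≡ᵇ_)
  private module Cᶻ = ColumnProducts GaussianIntegers.ℤ[i] n H

  φ̂-colProd : ∀ a b → φ̂ (Cᶻ.colProd a b) ≈ℍ colProd a b
  φ̂-colProd a b = ≈ℍ-trans (φ̂-sum n _) (sum-cong n (λ c _ → begin
    φ̂ ((ℍᶻ.evalSU (H c a) ℍᶻ.ℍ*) ℍᶻ.*ℍ ℍᶻ.evalSU (H c b))  ≈⟨ φ̂-* (ℍᶻ.evalSU (H c a) ℍᶻ.ℍ*) (ℍᶻ.evalSU (H c b)) ⟩
    φ̂ (ℍᶻ.evalSU (H c a) ℍᶻ.ℍ*) *ℍ φ̂ (ℍᶻ.evalSU (H c b))   ≈⟨ *ℍ-cong (φ̂-ℍ* (ℍᶻ.evalSU (H c a))) ≈ℍ-refl ⟩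
    (φ̂ (ℍᶻ.evalSU (H c a)) ℍ*) *ℍ φ̂ (ℍᶻ.evalSU (H c b))   ≈⟨ *ℍ-cong (ℍ*-cong (φ̂-evalSU (H c a))) (φ̂-evalSU (H c b)) ⟩
    (evalSU (H c a) ℍ*) *ℍ evalSU (H c b)                  ∎))
    where open ℍ-Reasoning

  columns-orthogonal : ∀ a b → a < n → b < n → colProd a b ≈ℍ (if a ≡ᵇ b then natℍ n else 0ℍ)
  columns-orthogonal a b a<n b<n with a ℕ.≟ b
  ... | yes ≡.refl rewrite ≡ᵇ-true {a} ≡.refl = colProd-diag a
  ... | no a≢b rewrite ≡ᵇ-false a≢b = begin
    colProd a b             ≈⟨ φ̂-colProd a b ⟨
    φ̂ (Cᶻ.colProd a b)      ≈⟨ φ̂-cong (GaussianColumns.colProd-offDiagonal n H (hadamard GaussianIntegers.ℤ[i]) a<n b<n a≢b) ⟩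
    φ̂ ℍᶻ.0ℍ                 ≈⟨ φ̂-0 ⟩
    0ℍ                      ∎
    where open ℍ-Reasoning

module BlockIndices (n₀ : ℕ) where

  open import Data.Nat using (_<_; _≤_; _+_; _*_; _∸_; _<ᵇ_; _≤ᵇ_)
  open import Data.Nat.DivMod using (_/_; _%_; +-distrib-/; m*n/n≡m; m<n⇒m/n≡0; m*n%n≡0; m<n⇒m%n≡m; [m+kn]%n≡m%n; %-congˡ; m≡m%n+[m/n]*n)
  open import Data.Nat.Tactic.RingSolver using (solve-∀)
  open import Data.Product using (_×_; _,_; proj₁; proj₂)
  open import Data.Sum using (_⊎_; inj₁; inj₂)
  open import Data.Empty using (⊥-elim)

  n : ℕ
  n = suc n₀

  m : ℕ
  m = 2 * n ∸ 1

  m≡n+n₀ : m ≡ n + n₀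
  m≡n+n₀ = ≡.trans (≡.cong (n₀ +_) (ℕ.+-identityʳ n)) (ℕ.+-suc n₀ n₀)

  1+m≡n+n : suc m ≡ n + n
  1+m≡n+n = ≡.trans (≡.cong suc m≡n+n₀) (≡.sym (ℕ.+-suc n n₀))

  order-split : 4 * n * n ≡ 2 * n + (m * n + m * n)
  order-split = ≡.trans (expand n₀) (≡.cong (λ k → 2 * n + (k * n + k * n)) (≡.sym m≡n+n₀))
    where
    expand : ∀ a → 4 * suc a * suc a ≡ 2 * suc a + ((suc a + a) * suc a + (suc a + a) * suc a)
    expand = solve-∀

  private
    shuffle : ∀ k t m → k + t + m ≡ m + k + t
    shuffle = solve-∀

  m<2n : m < 2 * n
  m<2n = ≡.subst₂ _<_ (≡.sym m≡n+n₀) (≡.cong (n +_) (≡.sym (ℕ.+-identityʳ n))) (ℕ.+-monoʳ-< n (ℕ.n<1+n n₀))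

  [l*n+c]/n≡l : ∀ l c → c < n → (l * n + c) / n ≡ l
  [l*n+c]/n≡l l c c<n = begin
    (l * n + c) / n      ≡⟨ +-distrib-/ (l * n) c (≡.subst (_< n) (≡.sym remainders) c<n) ⟩
    l * n / n + c / n    ≡⟨ ≡.cong₂ _+_ (m*n/n≡m l n) (m<n⇒m/n≡0 c<n) ⟩
    l + 0                ≡⟨ ℕ.+-identityʳ l ⟩
    l                    ∎
    where
    open ≡.≡-Reasoning
    remainders : (l * n) % n + c % n ≡ c
    remainders = ≡.cong₂ _+_ (m*n%n≡0 l n) (m<n⇒m%n≡m c<n)

  decompose : ∀ i → (i / n) * n + i % n ≡ i
  decompose i = ≡.trans (ℕ.+-comm _ (i % n)) (≡.sym (m≡m%n+[m/n]*n i n))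

  [l*n+c]%n≡c : ∀ l c → c < n → (l * n + c) % n ≡ c
  [l*n+c]%n≡c l c c<n = ≡.trans (%-congˡ (ℕ.+-comm (l * n) c)) (≡.trans ([m+kn]%n≡m%n c l n) (m<n⇒m%n≡m c<n))

  sel<n : ∀ {q} → q < 2 * n → sel n q < n
  sel<n {q} q<2n with n ℕ.≤? q
  ... | yes n≤q rewrite ≤ᵇ-true n≤q =
    ℕ.+-cancelˡ-< n _ _ (≡.subst₂ _<_ (≡.sym (ℕ.m+[n∸m]≡n n≤q)) (≡.cong (n +_) (ℕ.+-identityʳ n)) q<2n)
  ... | no n≰q rewrite ≤ᵇ-false (ℕ.≰⇒> n≰q) = ℕ.≰⇒> n≰q

  sel-flip : ∀ {a b} → a ≢ b → sel n a ≡ sel n b → (n ≤ᵇ a) ≡ not (n ≤ᵇ b)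
  sel-flip {a} {b} a≢b eq with n ℕ.≤? a | n ℕ.≤? b
  ... | yes n≤a | yes n≤b rewrite ≤ᵇ-true n≤a | ≤ᵇ-true n≤b = ⊥-elim (a≢b (ℕ.∸-cancelʳ-≡ n≤a n≤b eq))
  ... | yes n≤a | no n≰b rewrite ≤ᵇ-true n≤a | ≤ᵇ-false (ℕ.≰⇒> n≰b) = ≡.refl
  ... | no n≰a | yes n≤b rewrite ≤ᵇ-false (ℕ.≰⇒> n≰a) | ≤ᵇ-true n≤b = ≡.refl
  ... | no n≰a | no n≰b rewrite ≤ᵇ-false (ℕ.≰⇒> n≰a) | ≤ᵇ-false (ℕ.≰⇒> n≰b) = ⊥-elim (a≢b eq)

  -- Construction.circIdx, restated without the parameters of the construction.
  circIdx : ℕ → ℕ → ℕ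
  circIdx k l = if k ≤ᵇ l then l ∸ k else (l + m) ∸ k

  circIdx-+ : ∀ k j → circIdx k (k + j) ≡ j
  circIdx-+ k j rewrite ≤ᵇ-true (ℕ.m≤m+n k j) = ℕ.m+n∸m≡n k j

  circIdx-< : ∀ {k l} → l < k → k ≤ m → circIdx k l ≡ (m ∸ k) + l
  circIdx-< {k} {l} l<k k≤m rewrite ≤ᵇ-false l<k = ≡.trans (≡.cong (_∸ k) (ℕ.+-comm l m)) (ℕ.+-∸-comm l k≤m)

  circIdx-spec : ∀ {k l} → k < m → l < m → circIdx k l < m × (k + circIdx k l ≡ l ⊎ k + circIdx k l ≡ l + m)
  circIdx-spec {k} {l} k<m l<m with k ℕ.≤? l
  ... | yes k≤l rewrite ≤ᵇ-true k≤l = ℕ.≤-<-trans (ℕ.m∸n≤m l k) l<m , inj₁ (ℕ.m+[n∸m]≡n k≤l)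
  ... | no k≰l rewrite ≤ᵇ-false (ℕ.≰⇒> k≰l) = bound , inj₂ wraps
    where
    wraps : k + (l + m ∸ k) ≡ l + m
    wraps = ℕ.m+[n∸m]≡n (ℕ.≤-trans (ℕ.<⇒≤ k<m) (ℕ.m≤n+m m l))
    bound : l + m ∸ k < m
    bound = ℕ.+-cancelˡ-< k _ _ (≡.subst (_< k + m) (≡.sym wraps) (ℕ.+-monoˡ-< m (ℕ.≰⇒> k≰l)))

  circIdx<m : ∀ {k l} → k < m → l < m → circIdx k l < m
  circIdx<m k<m l<m = proj₁ (circIdx-spec k<m l<m)

  circIdx-injective : ∀ {k k′ l} → k < m → k′ < m → l < m → circIdx k l ≡ circIdx k′ l → k ≡ k′
  circIdx-injective {k} {k′} {l} k<m k′<m l<m eq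
    with proj₂ (circIdx-spec k<m l<m) | proj₂ (circIdx-spec k′<m l<m)
  ... | inj₁ p | inj₁ q = ℕ.+-cancelʳ-≡ t k k′ (≡.trans p (≡.sym (≡.trans (≡.cong (k′ +_) eq) q)))
    where t = circIdx k l
  ... | inj₂ p | inj₂ q = ℕ.+-cancelʳ-≡ t k k′ (≡.trans p (≡.sym (≡.trans (≡.cong (k′ +_) eq) q)))
    where t = circIdx k l
  ... | inj₁ p | inj₂ q = ⊥-elim (ℕ.<⇒≱ k′<m (≡.subst (m ≤_) (≡.sym k′≡m+k) (ℕ.m≤m+n m k)))
    where
    t = circIdx k l
    k′≡m+k : k′ ≡ m + k
    k′≡m+k = ℕ.+-cancelʳ-≡ t k′ (m + k)
      (≡.trans (≡.cong (k′ +_) eq) (≡.trans q (≡.trans (≡.cong (_+ m) (≡.sym p)) (shuffle k t m))))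
  ... | inj₂ p | inj₁ q = ⊥-elim (ℕ.<⇒≱ k<m (≡.subst (m ≤_) (≡.sym k≡m+k′) (ℕ.m≤m+n m k′)))
    where
    t = circIdx k l
    k≡m+k′ : k ≡ m + k′
    k≡m+k′ = ℕ.+-cancelʳ-≡ t k (m + k′)
      (≡.trans p (≡.trans (≡.cong (_+ m) (≡.trans (≡.sym q) (≡.cong (k′ +_) (≡.sym eq)))) (shuffle k′ t m)))

  -- The t-th first-row block of A and of B is ±C_(fold t).
  fold : ℕ → ℕ
  fold t = if t <ᵇ n then t else m ∸ t

  fold-< : ∀ {t} → t < n → fold t ≡ t
  fold-< t<n rewrite <ᵇ-true t<n = ≡.refl

  fold-+ : ∀ {s} → s < n₀ → fold (n + s) ≡ suc (n₀ ∸ suc s)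
  fold-+ {s} s<n₀ rewrite <ᵇ-false (ℕ.m≤m+n n s) =
    ≡.trans (≡.cong (_∸ (n + s)) m≡n+n₀) (≡.trans (ℕ.[m+n]∸[m+o]≡n∸o n n₀ s) (ℕ.+-∸-assoc 1 s<n₀))

  fold<n : ∀ {t} → t < m → fold t < n
  fold<n {t} t<m with t ℕ.<? n
  ... | yes t<n rewrite <ᵇ-true t<n = t<n
  ... | no t≮n rewrite <ᵇ-false (ℕ.≮⇒≥ t≮n) =
    ℕ.≤-<-trans (ℕ.∸-monoʳ-≤ m (ℕ.≮⇒≥ t≮n))
                (≡.subst (_< n) (≡.sym (≡.trans (≡.cong (_∸ n) m≡n+n₀) (ℕ.m+n∸m≡n n n₀))) (ℕ.n<1+n n₀))

  fold≡0 : ∀ {t} → t < m → fold t ≡ 0 → t ≡ 0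
  fold≡0 {t} t<m eq with t ℕ.<? n
  ... | yes t<n rewrite <ᵇ-true t<n = eq
  ... | no t≮n rewrite <ᵇ-false (ℕ.≮⇒≥ t≮n) = ⊥-elim (ℕ.<⇒≱ t<m (ℕ.m∸n≡0⇒m≤n eq))

  fold-flip : ∀ {t t′} → t < m → t′ < m → t ≢ t′ → fold t ≡ fold t′ → (t <ᵇ n) ≡ not (t′ <ᵇ n)
  fold-flip {t} {t′} t<m t′<m t≢t′ eq with t ℕ.<? n | t′ ℕ.<? n
  ... | yes p | yes q rewrite <ᵇ-true p | <ᵇ-true q = ⊥-elim (t≢t′ eq)
  ... | yes p | no q rewrite <ᵇ-true p | <ᵇ-false (ℕ.≮⇒≥ q) = ≡.refl
  ... | no p | yes q rewrite <ᵇ-false (ℕ.≮⇒≥ p) | <ᵇ-true q = ≡.refl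
  ... | no p | no q rewrite <ᵇ-false (ℕ.≮⇒≥ p) | <ᵇ-false (ℕ.≮⇒≥ q) =
    ⊥-elim (t≢t′ (ℕ.∸-cancelˡ-≡ (ℕ.<⇒≤ t<m) (ℕ.<⇒≤ t′<m) eq))

  sel-1+≡0 : ∀ k → sel n (suc k) ≡ 0 → (n ≤ᵇ suc k) ≡ true
  sel-1+≡0 k eq with n ℕ.≤? suc k
  ... | yes n≤1+k = ≤ᵇ-true n≤1+k
  ... | no n≰1+k rewrite ≤ᵇ-false (ℕ.≰⇒> n≰1+k) = ⊥-elim (ℕ.1+n≢0 eq)

module Layout (n₀ : ℕ) (H : HMat) where

  open BlockIndices n₀ public
  open import Data.Nat using (_<_; _+_; _*_; _<ᵇ_; _≤ᵇ_)
  open import Data.Nat.DivMod using (_/_; _%_)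
  open import Data.Product using (_×_)

  Ĥ : HMat
  Ĥ = kronH n H

  -- Column blocks come in pairs: the two halves of the first block column
  -- (topPair), and the l-th blocks of the second and third block columns.
  data Pair : Set where
    topPair : Pair
    blockPair : ℕ → Pair

  col₁ col₂ : Pair → ℕ → Region
  col₁ topPair c = top c
  col₁ (blockPair l) c = mid (l * n + c)
  col₂ topPair c = top (n + c)
  col₂ (blockPair l) c = bot (l * n + c)

  -- blockRow b k r is row r of the k-th block row of [E A B] (b = false)
  -- or of [−E B A] (b = true).
  data RowKind : Set where
    topRow : ℕ → RowKind
    blockRow : Bool → ℕ → ℕ → RowKind

  kind : Region → RowKind
  kind (top a) = topRow a
  kind (mid i) = blockRow false (i / n) (i % n)
  kind (bot i) = blockRow true (i / n) (i % n)

  -- In the first (second) column block of π, row κ is negIf (sign₁ κ π)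
  -- (resp. sign₂) of coeff κ π times row xrow κ π of X.
  xrow : RowKind → Pair → ℕ
  xrow (topRow a) π = 0
  xrow (blockRow b k r) topPair = sel n (suc k)
  xrow (blockRow b k r) (blockPair l) = fold (circIdx k l)

  coeff : RowKind → Pair → SUnit
  coeff (topRow a) topPair = conjSU (Ĥ 0 a)
  coeff (topRow a) (blockPair l) = conjSU (Ĥ (suc l) a)
  coeff (blockRow b k r) topPair = conjSU (H 0 r)
  coeff (blockRow b k r) (blockPair l) = conjSU (H (fold (circIdx k l)) r)

  wraps : ℕ → ℕ → Bool
  wraps k l = not (circIdx k l <ᵇ n)

  sign₁ sign₂ : RowKind → Pair → Bool
  sign₁ (topRow a) π = false
  sign₁ (blockRow b k r) topPair = b
  sign₁ (blockRow b k r) (blockPair l) = b ∧ wraps k l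
  sign₂ (topRow a) topPair = false
  sign₂ (topRow a) (blockPair l) = true
  sign₂ (blockRow b k r) topPair = b xor (n ≤ᵇ suc k)
  sign₂ (blockRow b k r) (blockPair l) = not b ∧ wraps k l

  Valid : RowKind → Set
  Valid (topRow a) = a < 2 * n
  Valid (blockRow b k r) = k < m × r < n

  index : RowKind → ℕ
  index (topRow a) = a
  index (blockRow false k r) = 2 * n + (k * n + r)
  index (blockRow true k r) = 2 * n + (m * n + (k * n + r))

module Entries (R : StarCRing) (n₀ : ℕ) {u : ℕ} (H : HMat) (X : SMat u) (x : Fin u → StarCRing.Carrier R) where

  open SignedUnits R
  open Layout n₀ H
  open import Data.Nat using (_<_; _+_; _*_; _∸_; _<ᵇ_; _≤ᵇ_)
  open import Data.Nat.DivMod using (_/_; _%_)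
  module Co = Construction n H X

  ev : Entry u → ℍ
  ev = evalE x

  X̃ : ℕ → ℕ → ℍ
  X̃ t c = ev (X t c)

  ev-lmul : ∀ t e → ev (lmulE t e) ≈ℍ (evalSU t *ℍ ev e)
  ev-lmul = evalE-lmul x

  ev-neg-lmul : ∀ t e → ev (negE (lmulE t e)) ≈ℍ ((-ℍ evalSU t) *ℍ ev e)
  ev-neg-lmul t e = ≈ℍ-trans (evalE-neg x (lmulE t e)) (≈ℍ-trans (-ℍ-cong (ev-lmul t e)) (≈ℍ-sym (*ℍ-negˡ _ _)))

  ev-lmul-negIf : ∀ s t e → ev (lmulE t (if s then negE e else e)) ≈ℍ (negIf s (evalSU t) *ℍ ev e)
  ev-lmul-negIf true t e = ≈ℍ-trans (ev-lmul t (negE e))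
    (≈ℍ-trans (*ℍ-cong ≈ℍ-refl (evalE-neg x e)) (≈ℍ-trans (*ℍ-negʳ _ _) (≈ℍ-sym (*ℍ-negˡ _ _))))
  ev-lmul-negIf false t e = ev-lmul t e

  ev-D : ∀ isB t r c → ev (Co.D isB t r c) ≈ℍ (negIf (isB ∧ not (t <ᵇ n)) (evalSU (conjSU (H (fold t) r))) *ℍ X̃ (fold t) c)
  ev-D isB t r c with t <ᵇ n
  ev-D false t r c | true = ev-lmul (conjSU (H t r)) (X t c)
  ev-D true t r c | true = ev-lmul (conjSU (H t r)) (X t c)
  ev-D false t r c | false = ev-lmul (conjSU (H (m ∸ t) r)) (X (m ∸ t) c)
  ev-D true t r c | false = ev-neg-lmul (conjSU (H (m ∸ t) r)) (X (m ∸ t) c)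

  X₂-< : ∀ j {c} → c < n → Co.X₂ j c ≡ X (sel n j) c
  X₂-< j c<n rewrite ≤ᵇ-false c<n with n ≤ᵇ j
  ... | true = ≡.refl
  ... | false = ≡.refl

  X₂-+ : ∀ j c → Co.X₂ j (n + c) ≡ (if n ≤ᵇ j then negE (X (sel n j) c) else X (sel n j) c)
  X₂-+ j c rewrite ≤ᵇ-true (ℕ.m≤m+n n c) | ℕ.m+n∸m≡n n₀ c with n ≤ᵇ j
  ... | true = ≡.refl
  ... | false = ≡.refl

  entry₁ : ∀ ρ π c → c < n →
    ev (Co.blockEntry ρ (col₁ π c)) ≈ℍ (negIf (sign₁ (kind ρ) π) (evalSU (coeff (kind ρ) π)) *ℍ X̃ (xrow (kind ρ) π) c)
  entry₁ (top a) topPair c c<n rewrite X₂-< 0 c<n = ev-lmul (conjSU (Ĥ 0 a)) (X 0 c)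
  entry₁ (mid i) topPair c c<n rewrite X₂-< (suc (i / n)) c<n = ev-lmul (conjSU (H 0 (i % n))) (X (sel n (suc (i / n))) c)
  entry₁ (bot i) topPair c c<n rewrite X₂-< (suc (i / n)) c<n = ev-neg-lmul (conjSU (H 0 (i % n))) (X (sel n (suc (i / n))) c)
  entry₁ (top a) (blockPair l) c c<n rewrite [l*n+c]/n≡l l c c<n | [l*n+c]%n≡c l c c<n = ev-lmul (conjSU (Ĥ (suc l) a)) (X 0 c)
  entry₁ (mid i) (blockPair l) c c<n rewrite [l*n+c]/n≡l l c c<n | [l*n+c]%n≡c l c c<n = ev-D false (circIdx (i / n) l) (i % n) c
  entry₁ (bot i) (blockPair l) c c<n rewrite [l*n+c]/n≡l l c c<n | [l*n+c]%n≡c l c c<n = ev-D true (circIdx (i / n) l) (i % n) c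

  entry₂ : ∀ ρ π c → c < n →
    ev (Co.blockEntry ρ (col₂ π c)) ≈ℍ (negIf (sign₂ (kind ρ) π) (evalSU (coeff (kind ρ) π)) *ℍ X̃ (xrow (kind ρ) π) c)
  entry₂ (top a) topPair c c<n rewrite X₂-+ 0 c = ev-lmul (conjSU (Ĥ 0 a)) (X 0 c)
  entry₂ (mid i) topPair c c<n rewrite X₂-+ (suc (i / n)) c = ev-lmul-negIf (n ≤ᵇ suc (i / n)) (conjSU (H 0 (i % n))) (X (sel n (suc (i / n))) c)
  entry₂ (bot i) topPair c c<n rewrite X₂-+ (suc (i / n)) c =
    ≈ℍ-trans (evalE-neg x (lmulE t (if s then negE e else e))) (≈ℍ-trans (-ℍ-cong (ev-lmul-negIf s t e))
      (≈ℍ-trans (≈ℍ-sym (*ℍ-negˡ _ _)) (*ℍ-cong (≈ℍ-sym (negIf-not s (evalSU t))) ≈ℍ-refl)))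
    where s = n ≤ᵇ suc (i / n)
          t = conjSU (H 0 (i % n))
          e = X (sel n (suc (i / n))) c
  entry₂ (top a) (blockPair l) c c<n rewrite [l*n+c]/n≡l l c c<n | [l*n+c]%n≡c l c c<n = ev-neg-lmul (conjSU (Ĥ (suc l) a)) (X 0 c)
  entry₂ (mid i) (blockPair l) c c<n rewrite [l*n+c]/n≡l l c c<n | [l*n+c]%n≡c l c c<n = ev-D true (circIdx (i / n) l) (i % n) c
  entry₂ (bot i) (blockPair l) c c<n rewrite [l*n+c]/n≡l l c c<n | [l*n+c]%n≡c l c c<n = ev-D false (circIdx (i / n) l) (i % n) c

module RowGram (R : StarCRing) (n₀ : ℕ) (H : HMat) where

  open SignedUnits R
  open Layout n₀ H
  open import Data.Nat using (_≡ᵇ_)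

  match : ℕ → ℕ → ℍ → ℍ → ℍ
  match τ τ′ K K′ = if τ ≡ᵇ τ′ then K *ℍ (K′ ℍ*) else 0ℍ

  pair : ℕ → ℕ → Bool → Bool → Bool → Bool → ℍ → ℍ → ℍ
  pair τ τ′ s₁ s₁′ s₂ s₂′ A B = match τ τ′ (negIf s₁ A) (negIf s₁′ B) +ℍ match τ τ′ (negIf s₂ A) (negIf s₂′ B)

  pairTerm : RowKind → RowKind → Pair → ℍ
  pairTerm κ κ′ π = pair (xrow κ π) (xrow κ′ π) (sign₁ κ π) (sign₁ κ′ π) (sign₂ κ π) (sign₂ κ′ π)
                         (evalSU (coeff κ π)) (evalSU (coeff κ′ π))

  rowGram : RowKind → RowKind → ℍ
  rowGram κ κ′ = pairTerm κ κ′ topPair +ℍ sumℍ m (λ l → pairTerm κ κ′ (blockPair l))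

  match-sym : ∀ τ τ′ K K′ → match τ′ τ K′ K ≈ℍ (match τ τ′ K K′ ℍ*)
  match-sym τ τ′ K K′ rewrite ≡ᵇ-sym τ′ τ with τ ≡ᵇ τ′
  ... | true = ≈ℍ-sym (≈ℍ-trans (ℍ*-anti-* K (K′ ℍ*)) (*ℍ-cong (ℍ*-involutive K′) ≈ℍ-refl))
  ... | false = ≈ℍ-sym ℍ*-0

  match-negIf : ∀ τ τ′ s s′ A B →
    match τ τ′ (negIf s A) (negIf s′ B) ≈ℍ (if τ ≡ᵇ τ′ then negIf (s xor s′) (A *ℍ (B ℍ*)) else 0ℍ)
  match-negIf τ τ′ s s′ A B with τ ≡ᵇ τ′
  ... | true = ≈ℍ-trans (*ℍ-cong ≈ℍ-refl (negIf-ℍ* s′ B)) (negIf-* s s′ A (B ℍ*))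
  ... | false = ≈ℍ-refl

  pair-cancel : ∀ τ τ′ s₁ s₁′ s₂ s₂′ A B → ((τ ≡ᵇ τ′) ≡ true → (s₁ xor s₁′) ≡ not (s₂ xor s₂′)) →
    pair τ τ′ s₁ s₁′ s₂ s₂′ A B ≈ℍ 0ℍ
  pair-cancel τ τ′ s₁ s₁′ s₂ s₂′ A B opposite = begin
    match τ τ′ (negIf s₁ A) (negIf s₁′ B) +ℍ match τ τ′ (negIf s₂ A) (negIf s₂′ B)
      ≈⟨ +ℍ-cong (match-negIf τ τ′ s₁ s₁′ A B) (match-negIf τ τ′ s₂ s₂′ A B) ⟩
    (if τ ≡ᵇ τ′ then negIf (s₁ xor s₁′) Y else 0ℍ) +ℍ (if τ ≡ᵇ τ′ then negIf (s₂ xor s₂′) Y else 0ℍ)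
      ≈⟨ cancel (τ ≡ᵇ τ′) ≡.refl ⟩
    0ℍ ∎
    where
    open ℍ-Reasoning
    Y = A *ℍ (B ℍ*)
    cancel : ∀ c → (τ ≡ᵇ τ′) ≡ c →
      ((if c then negIf (s₁ xor s₁′) Y else 0ℍ) +ℍ (if c then negIf (s₂ xor s₂′) Y else 0ℍ)) ≈ℍ 0ℍ
    cancel true eq rewrite opposite eq = ≈ℍ-trans (+ℍ-comm _ _) (negIf-cancel (s₂ xor s₂′) Y)
    cancel false eq = +ℍ-identityˡ 0ℍ

  pair-same : ∀ τ s₁ s₁′ s₂ s₂′ A B →
    pair τ τ s₁ s₁′ s₂ s₂′ A B ≈ℍ (negIf (s₁ xor s₁′) (A *ℍ (B ℍ*)) +ℍ negIf (s₂ xor s₂′) (A *ℍ (B ℍ*)))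
  pair-same τ s₁ s₁′ s₂ s₂′ A B = ≈ℍ-trans (+ℍ-cong (match-negIf τ τ s₁ s₁′ A B) (match-negIf τ τ s₂ s₂′ A B))
    (≈ℍ-reflexive (≡.cong (λ c → (if c then negIf (s₁ xor s₁′) Y else 0ℍ) +ℍ (if c then negIf (s₂ xor s₂′) Y else 0ℍ))
                          (≡ᵇ-true {τ} ≡.refl)))
    where Y = A *ℍ (B ℍ*)

  rowGram-sym : ∀ κ κ′ → rowGram κ′ κ ≈ℍ (rowGram κ κ′ ℍ*)
  rowGram-sym κ κ′ = ≈ℍ-trans
    (+ℍ-cong (pairTerm-sym topPair) (≈ℍ-trans (sum-cong m (λ l _ → pairTerm-sym (blockPair l))) (≈ℍ-sym (sum-ℍ* m _))))
    (≈ℍ-sym (ℍ*-+ _ _))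
    where
    pairTerm-sym : ∀ π → pairTerm κ′ κ π ≈ℍ (pairTerm κ κ′ π ℍ*)
    pairTerm-sym π = ≈ℍ-trans (+ℍ-cong (match-sym τ τ′ (negIf (sign₁ κ π) A) (negIf (sign₁ κ′ π) B))
                                       (match-sym τ τ′ (negIf (sign₂ κ π) A) (negIf (sign₂ κ′ π) B)))
                              (≈ℍ-sym (ℍ*-+ _ _))
      where τ = xrow κ π; τ′ = xrow κ′ π; A = evalSU (coeff κ π); B = evalSU (coeff κ′ π)

module RowPositions (n₀ : ℕ) {u : ℕ} (H : HMat) (X : SMat u) where

  open Layout n₀ H
  open import Data.Nat using (_<_; _+_; _*_; _∸_)
  open import Data.Nat.DivMod using (m%n<n; m<n*o⇒m/o<n)
  open import Data.Product using (_,_)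
  module Co = Construction n H X

  region-top : ∀ {q} → q < 2 * n → Co.region q ≡ top q
  region-top q<2n rewrite <ᵇ-true q<2n = ≡.refl

  region-mid : ∀ {i} → i < m * n → Co.region (2 * n + i) ≡ mid i
  region-mid {i} i<mn rewrite <ᵇ-false (ℕ.m≤m+n (2 * n) i) | ℕ.m+n∸m≡n (2 * n) i | <ᵇ-true i<mn = ≡.refl

  region-bot : ∀ {i} → i < m * n → Co.region (2 * n + (m * n + i)) ≡ bot i
  region-bot {i} i<mn
    rewrite <ᵇ-false (ℕ.m≤m+n (2 * n) (m * n + i)) | ℕ.m+n∸m≡n (2 * n) (m * n + i)
          | <ᵇ-false (ℕ.m≤m+n (m * n) i) | ℕ.m+n∸m≡n (m * n) i = ≡.refl

  data Position : ℕ → Set where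
    top-position : ∀ {a} → a < 2 * n → Position a
    mid-position : ∀ {i} → i < m * n → Position (2 * n + i)
    bot-position : ∀ {i} → i < m * n → Position (2 * n + (m * n + i))

  position : ∀ {p} → p < 4 * n * n → Position p
  position {p} p<N with p ℕ.<? 2 * n
  ... | yes p<2n = top-position p<2n
  ... | no p≮2n with p ∸ 2 * n ℕ.<? m * n
  ...   | yes j<mn = ≡.subst Position (ℕ.m+[n∸m]≡n (ℕ.≮⇒≥ p≮2n)) (mid-position j<mn)
  ...   | no j≮mn = ≡.subst Position p≡ (bot-position i<mn)
    where
    i = p ∸ 2 * n ∸ m * n
    p≡ : 2 * n + (m * n + i) ≡ p
    p≡ = ≡.trans (≡.cong (2 * n +_) (ℕ.m+[n∸m]≡n (ℕ.≮⇒≥ j≮mn))) (ℕ.m+[n∸m]≡n (ℕ.≮⇒≥ p≮2n))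
    i<mn : i < m * n
    i<mn = ℕ.+-cancelˡ-< (2 * n + m * n) _ _
      (≡.subst₂ _<_ (≡.trans (≡.sym p≡) (≡.sym (ℕ.+-assoc (2 * n) (m * n) i)))
                    (≡.trans order-split (≡.sym (ℕ.+-assoc (2 * n) (m * n) (m * n)))) p<N)

  valid-region : ∀ {p} → Position p → Valid (kind (Co.region p))
  valid-region (top-position a<2n) rewrite region-top a<2n = a<2n
  valid-region {p} (mid-position {i} i<mn) rewrite region-mid i<mn = m<n*o⇒m/o<n i<mn , m%n<n i n
  valid-region {p} (bot-position {i} i<mn) rewrite region-bot i<mn = m<n*o⇒m/o<n i<mn , m%n<n i n

  index-kind : ∀ {p} → Position p → index (kind (Co.region p)) ≡ p
  index-kind (top-position a<2n) rewrite region-top a<2n = ≡.refl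
  index-kind (mid-position {i} i<mn) rewrite region-mid i<mn = ≡.cong (2 * n +_) (decompose i)
  index-kind (bot-position {i} i<mn) rewrite region-bot i<mn = ≡.cong (λ j → 2 * n + (m * n + j)) (decompose i)

module Weights (R : StarCRing) where

  open QuaternionAlgebra R
  open StarCRing R
  open import Algebra.Properties.Ring ring using (-0#≈0#)
  open import Data.Product using (_,_)

  private
    Σ : ∀ {u} → (Fin u → Carrier) → Carrier
    Σ {u} = sumFin 0# _+_ u

  Σ-cong : ∀ {u} {f g : Fin u → Carrier} → (∀ ℓ → f ℓ ≈ g ℓ) → Σ f ≈ Σ g
  Σ-cong {zero} f≈g = refl
  Σ-cong {suc u} f≈g = +-cong (f≈g Fin.zero) (Σ-cong (f≈g ∘ Fin.suc))
    where import Data.Fin as Fin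

  conj-Σ : ∀ {u} (f : Fin u → Carrier) → conj (Σ f) ≈ Σ (conj ∘ f)
  conj-Σ {zero} f = conj-0
  conj-Σ {suc u} f = trans (conj-+ _ _) (+-congˡ (conj-Σ (f ∘ Data.Fin.suc)))

  *-Σ : ∀ {u} c (f : Fin u → Carrier) → c * Σ f ≈ Σ (λ ℓ → c * f ℓ)
  *-Σ {zero} c f = zeroʳ c
  *-Σ {suc u} c f = trans (distribˡ _ _ _) (+-congˡ (*-Σ c (f ∘ Data.Fin.suc)))

  module _ {u} (s : Fin u → ℕ) (x : Fin u → Carrier) where

    σ-central : ∀ p → (σ s x *ℍ p) ≈ℍ (p *ℍ σ s x)
    σ-central p = real-central _ p (trans (conj-Σ {u} _) (Σ-cong {u} (λ ℓ → trans (conj-natMul (s ℓ) _) (natMul-cong (s ℓ) |x|²-real))))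
      where
      |x|²-real : ∀ {a} → conj (a * conj a) ≈ a * conj a
      |x|²-real {a} = trans (conj-* a _) (trans (*-congˡ (conj-invol a)) (*-comm _ _))

    σ-scale : ∀ k → σ (λ ℓ → k ℕ.* s ℓ) x ≈ℍ (natℍ k *ℍ σ s x)
    σ-scale k = re , im
      where
      open import Relation.Binary.Reasoning.Setoid setoid
      S = Σ (λ ℓ → natMul (s ℓ) (x ℓ * conj (x ℓ)))
      re : Σ (λ ℓ → natMul (k ℕ.* s ℓ) (x ℓ * conj (x ℓ))) ≈ natMul k 1# * S - 0# * conj 0#
      re = begin
        Σ (λ ℓ → natMul (k ℕ.* s ℓ) (x ℓ * conj (x ℓ)))     ≈⟨ Σ-cong {u} (λ ℓ → natMul-* k (s ℓ) _) ⟩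
        Σ (λ ℓ → natMul k 1# * natMul (s ℓ) (x ℓ * conj (x ℓ))) ≈⟨ *-Σ {u} _ _ ⟨
        natMul k 1# * S                                      ≈⟨ +-identityʳ _ ⟨
        natMul k 1# * S + 0#                                 ≈⟨ +-congˡ (trans (-‿cong (zeroˡ _)) -0#≈0#) ⟨
        natMul k 1# * S - 0# * conj 0#                       ∎
      im : 0# ≈ natMul k 1# * 0# + 0# * conj S
      im = sym (trans (+-cong (zeroʳ _) (zeroˡ _)) (+-identityʳ 0#))

module InnerProducts (R : StarCRing) (n₀ : ℕ) {u : ℕ} (H : HMat) (X : SMat u) (s : Fin u → ℕ)
  (isQOD : IsQOD u (suc n₀) X s) (x : Fin u → StarCRing.Carrier R) where

  open SignedUnits R
  open Layout n₀ H
  open Entries R n₀ H X x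
  open RowPositions n₀ H X using (region-top; region-mid; region-bot)
  open RowGram R n₀ H
  open import Data.Nat using (_<_; _+_; _*_; _≡ᵇ_; s≤s; z≤n)
  open import Data.Unit using (⊤)
  open import Data.Product using (_,_)

  σ₀ : ℍ
  σ₀ = σ s x

  ValidPair : Pair → Set
  ValidPair topPair = ⊤
  ValidPair (blockPair l) = l < m

  xrow<n : ∀ κ π → Valid κ → ValidPair π → xrow κ π < n
  xrow<n (topRow a) π _ _ = s≤s z≤n
  xrow<n (blockRow b k r) topPair (k<m , _) _ = sel<n (ℕ.≤-<-trans k<m m<2n)
  xrow<n (blockRow b k r) (blockPair l) (k<m , _) l<m = fold<n (circIdx<m k<m l<m)

  match-σ : ∀ b p q → (p *ℍ ((if b then σ₀ else 0ℍ) *ℍ q)) ≈ℍ ((if b then p *ℍ q else 0ℍ) *ℍ σ₀)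
  match-σ true p q = ≈ℍ-trans (*ℍ-cong ≈ℍ-refl (Weights.σ-central R s x q)) (≈ℍ-sym (*ℍ-assoc _ _ _))
  match-σ false p q = ≈ℍ-trans (*ℍ-cong ≈ℍ-refl (*ℍ-zeroˡ q)) (≈ℍ-trans (*ℍ-zeroʳ p) (≈ℍ-sym (*ℍ-zeroˡ σ₀)))

  block-inner : ∀ K K′ {τ τ′} → τ < n → τ′ < n → (f g : ℕ → ℍ) →
    (∀ c → c < n → f c ≈ℍ (K *ℍ X̃ τ c)) → (∀ c → c < n → g c ≈ℍ (K′ *ℍ X̃ τ′ c)) →
    sumℍ n (λ c → f c *ℍ (g c ℍ*)) ≈ℍ (match τ τ′ K K′ *ℍ σ₀)
  block-inner K K′ {τ} {τ′} τ<n τ′<n f g f≈ g≈ = begin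
    sumℍ n (λ c → f c *ℍ (g c ℍ*))
      ≈⟨ sum-cong n (λ c c<n → ≈ℍ-trans (*ℍ-cong (f≈ c c<n) (ℍ*-cong (g≈ c c<n))) (regroup c)) ⟩
    sumℍ n (λ c → K *ℍ ((X̃ τ c *ℍ (X̃ τ′ c ℍ*)) *ℍ (K′ ℍ*)))      ≈⟨ sum-*ˡ n K _ ⟨
    K *ℍ sumℍ n (λ c → (X̃ τ c *ℍ (X̃ τ′ c ℍ*)) *ℍ (K′ ℍ*))        ≈⟨ *ℍ-cong ≈ℍ-refl (sum-*ʳ n (K′ ℍ*) _) ⟨
    K *ℍ (sumℍ n (λ c → X̃ τ c *ℍ (X̃ τ′ c ℍ*)) *ℍ (K′ ℍ*))        ≈⟨ *ℍ-cong ≈ℍ-refl (*ℍ-cong (isQOD R x τ τ′ τ<n τ′<n) ≈ℍ-refl) ⟩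
    K *ℍ ((if τ ≡ᵇ τ′ then σ₀ else 0ℍ) *ℍ (K′ ℍ*))                ≈⟨ match-σ (τ ≡ᵇ τ′) K (K′ ℍ*) ⟩
    match τ τ′ K K′ *ℍ σ₀                                          ∎
    where
    open ℍ-Reasoning
    regroup : ∀ c → ((K *ℍ X̃ τ c) *ℍ ((K′ *ℍ X̃ τ′ c) ℍ*)) ≈ℍ (K *ℍ ((X̃ τ c *ℍ (X̃ τ′ c ℍ*)) *ℍ (K′ ℍ*)))
    regroup c = begin
      (K *ℍ X̃ τ c) *ℍ ((K′ *ℍ X̃ τ′ c) ℍ*)          ≈⟨ *ℍ-cong ≈ℍ-refl (ℍ*-anti-* K′ _) ⟩
      (K *ℍ X̃ τ c) *ℍ ((X̃ τ′ c ℍ*) *ℍ (K′ ℍ*))     ≈⟨ *ℍ-assoc _ _ _ ⟩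
      K *ℍ (X̃ τ c *ℍ ((X̃ τ′ c ℍ*) *ℍ (K′ ℍ*)))     ≈⟨ *ℍ-cong ≈ℍ-refl (*ℍ-assoc _ _ _) ⟨
      K *ℍ ((X̃ τ c *ℍ (X̃ τ′ c ℍ*)) *ℍ (K′ ℍ*))     ∎

  pairSum : (Region → ℍ) → Pair → ℍ
  pairSum G π = sumℍ n (λ c → G (col₁ π c)) +ℍ sumℍ n (λ c → G (col₂ π c))

  sum-regions : ∀ (G : Region → ℍ) →
    sumℍ (4 * n * n) (λ q → G (Co.region q)) ≈ℍ (pairSum G topPair +ℍ sumℍ m (λ l → pairSum G (blockPair l)))
  sum-regions G = begin
    sumℍ (4 * n * n) (G ∘ Co.region)
      ≈⟨ ≈ℍ-trans (sum-congˡ _ order-split) (sum-split (2 * n) (m * n + m * n) _) ⟩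
    sumℍ (2 * n) (G ∘ Co.region) +ℍ sumℍ (m * n + m * n) (λ q → G (Co.region (2 * n + q)))
      ≈⟨ +ℍ-cong (sum-cong (2 * n) (λ q q<2n → ≈ℍ-reflexive (≡.cong G (region-top q<2n))))
                 (sum-split (m * n) (m * n) _) ⟩
    sumℍ (2 * n) (G ∘ top) +ℍ (sumℍ (m * n) (λ i → G (Co.region (2 * n + i))) +ℍ sumℍ (m * n) (λ i → G (Co.region (2 * n + (m * n + i)))))
      ≈⟨ +ℍ-cong (≈ℍ-trans (sum-congˡ _ (≡.cong (n +_) (ℕ.+-identityʳ n))) (sum-split n n _))
                 (+ℍ-cong (≈ℍ-trans (sum-cong (m * n) (λ i i<mn → ≈ℍ-reflexive (≡.cong G (region-mid i<mn)))) (sum-blocks m n _))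
                          (≈ℍ-trans (sum-cong (m * n) (λ i i<mn → ≈ℍ-reflexive (≡.cong G (region-bot i<mn)))) (sum-blocks m n _))) ⟩
    pairSum G topPair +ℍ (sumℍ m (λ l → sumℍ n (λ c → G (col₁ (blockPair l) c))) +ℍ sumℍ m (λ l → sumℍ n (λ c → G (col₂ (blockPair l) c))))
      ≈⟨ +ℍ-cong ≈ℍ-refl (≈ℍ-sym (sum-+ m _ _)) ⟩
    pairSum G topPair +ℍ sumℍ m (λ l → pairSum G (blockPair l)) ∎
    where open ℍ-Reasoning

  rowInner : Region → Region → ℍ
  rowInner ρ ρ′ = sumℍ (4 * n * n) (λ q → ev (Co.blockEntry ρ (Co.region q)) *ℍ (ev (Co.blockEntry ρ′ (Co.region q)) ℍ*))

  pairSum-inner : ∀ ρ ρ′ π → Valid (kind ρ) → Valid (kind ρ′) → ValidPair π →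
    pairSum (λ r → ev (Co.blockEntry ρ r) *ℍ (ev (Co.blockEntry ρ′ r) ℍ*)) π ≈ℍ (pairTerm (kind ρ) (kind ρ′) π *ℍ σ₀)
  pairSum-inner ρ ρ′ π v v′ vπ = ≈ℍ-trans
    (+ℍ-cong (block-inner _ _ τ<n τ′<n _ _ (entry₁ ρ π) (entry₁ ρ′ π)) (block-inner _ _ τ<n τ′<n _ _ (entry₂ ρ π) (entry₂ ρ′ π)))
    (≈ℍ-sym (*ℍ-distribʳ σ₀ _ _))
    where
    τ<n = xrow<n (kind ρ) π v vπ
    τ′<n = xrow<n (kind ρ′) π v′ vπ

  rowInner≈rowGram : ∀ ρ ρ′ → Valid (kind ρ) → Valid (kind ρ′) → rowInner ρ ρ′ ≈ℍ (rowGram (kind ρ) (kind ρ′) *ℍ σ₀)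
  rowInner≈rowGram ρ ρ′ v v′ = begin
    rowInner ρ ρ′                                               ≈⟨ sum-regions F ⟩
    pairSum F topPair +ℍ sumℍ m (λ l → pairSum F (blockPair l))
      ≈⟨ +ℍ-cong (pairSum-inner ρ ρ′ topPair v v′ _) (sum-cong m (λ l l<m → pairSum-inner ρ ρ′ (blockPair l) v v′ l<m)) ⟩
    (pairTerm κ κ′ topPair *ℍ σ₀) +ℍ sumℍ m (λ l → pairTerm κ κ′ (blockPair l) *ℍ σ₀)
      ≈⟨ +ℍ-cong ≈ℍ-refl (sum-*ʳ m σ₀ _) ⟨
    (pairTerm κ κ′ topPair *ℍ σ₀) +ℍ (sumℍ m (λ l → pairTerm κ κ′ (blockPair l)) *ℍ σ₀)
      ≈⟨ *ℍ-distribʳ σ₀ _ _ ⟨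
    rowGram κ κ′ *ℍ σ₀                                          ∎
    where
    open ℍ-Reasoning
    κ = kind ρ
    κ′ = kind ρ′
    F : Region → ℍ
    F r = ev (Co.blockEntry ρ r) *ℍ (ev (Co.blockEntry ρ′ r) ℍ*)

module FoldedSums (R : StarCRing) (n₀ : ℕ) where

  open SignedUnits R
  open BlockIndices n₀
  open import Data.Nat using (_≤_; _+_; _∸_; _<ᵇ_)

  sum-rotate : ∀ k (G : ℕ → ℍ) → k ≤ m → sumℍ m (λ l → G (circIdx k l)) ≈ℍ sumℍ m G
  sum-rotate k G k≤m = begin
    sumℍ m (λ l → G (circIdx k l))                ≈⟨ sum-congˡ _ (≡.sym (ℕ.m+[n∸m]≡n k≤m)) ⟩
    sumℍ (k + (m ∸ k)) (λ l → G (circIdx k l))    ≈⟨ sum-split k (m ∸ k) _ ⟩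
    sumℍ k (λ l → G (circIdx k l)) +ℍ sumℍ (m ∸ k) (λ j → G (circIdx k (k + j)))
      ≈⟨ +ℍ-cong (sum-cong k (λ l l<k → ≈ℍ-reflexive (≡.cong G (circIdx-< l<k k≤m))))
                 (sum-cong (m ∸ k) (λ j _ → ≈ℍ-reflexive (≡.cong G (circIdx-+ k j)))) ⟩
    sumℍ k (λ l → G (m ∸ k + l)) +ℍ sumℍ (m ∸ k) G  ≈⟨ +ℍ-comm _ _ ⟩
    sumℍ (m ∸ k) G +ℍ sumℍ k (λ l → G (m ∸ k + l))  ≈⟨ sum-split (m ∸ k) k G ⟨
    sumℍ (m ∸ k + k) G                              ≈⟨ sum-congˡ G (ℕ.m∸n+n≡m k≤m) ⟩
    sumℍ m G                                        ∎
    where open ℍ-Reasoning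

  private
    sum-m : ∀ (G : ℕ → ℍ) → sumℍ m G ≈ℍ (sumℍ n G +ℍ sumℍ n₀ (λ s → G (n + s)))
    sum-m G = ≈ℍ-trans (sum-congˡ G m≡n+n₀) (sum-split n n₀ G)

    sum-fold-< : ∀ (Y : ℕ → ℍ) → sumℍ n (λ t → Y (fold t)) ≈ℍ sumℍ n Y
    sum-fold-< Y = sum-cong n (λ t t<n → ≈ℍ-reflexive (≡.cong Y (fold-< t<n)))

    sum-fold-+ : ∀ (Y : ℕ → ℍ) → sumℍ n₀ (λ s → Y (fold (n + s))) ≈ℍ sumℍ n₀ (λ s → Y (suc s))
    sum-fold-+ Y = ≈ℍ-trans (sum-cong n₀ (λ s s<n₀ → ≈ℍ-reflexive (≡.cong Y (fold-+ s<n₀))))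
                            (≈ℍ-sym (sum-reverse n₀ (λ s → Y (suc s))))

  sum-fold : ∀ (Y : ℕ → ℍ) → (Y 0 +ℍ sumℍ m (λ t → Y (fold t))) ≈ℍ (sumℍ n Y +ℍ sumℍ n Y)
  sum-fold Y = begin
    Y 0 +ℍ sumℍ m (λ t → Y (fold t))                                      ≈⟨ +ℍ-cong ≈ℍ-refl (sum-m _) ⟩
    Y 0 +ℍ (sumℍ n (λ t → Y (fold t)) +ℍ sumℍ n₀ (λ s → Y (fold (n + s)))) ≈⟨ +ℍ-cong ≈ℍ-refl (+ℍ-cong (sum-fold-< Y) (sum-fold-+ Y)) ⟩
    Y 0 +ℍ (sumℍ n Y +ℍ sumℍ n₀ (λ s → Y (suc s)))                        ≈⟨ +ℍ-cong ≈ℍ-refl (+ℍ-comm _ _) ⟩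
    Y 0 +ℍ (sumℍ n₀ (λ s → Y (suc s)) +ℍ sumℍ n Y)                        ≈⟨ +ℍ-assoc _ _ _ ⟨
    (Y 0 +ℍ sumℍ n₀ (λ s → Y (suc s))) +ℍ sumℍ n Y                        ≈⟨ +ℍ-cong (sum-head n₀ Y) ≈ℍ-refl ⟨
    sumℍ n Y +ℍ sumℍ n Y                                                  ∎
    where open ℍ-Reasoning

  sum-fold-signed : ∀ (Y : ℕ → ℍ) → sumℍ m (λ t → negIf (not (t <ᵇ n)) (Y (fold t))) ≈ℍ Y 0
  sum-fold-signed Y = begin
    sumℍ m (λ t → negIf (not (t <ᵇ n)) (Y (fold t)))
      ≈⟨ sum-m _ ⟩
    sumℍ n (λ t → negIf (not (t <ᵇ n)) (Y (fold t))) +ℍ sumℍ n₀ (λ s → negIf (not ((n + s) <ᵇ n)) (Y (fold (n + s))))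
      ≈⟨ +ℍ-cong (sum-cong n (λ t t<n → negIf-≡ (Y (fold t)) (≡.cong not (<ᵇ-true t<n))))
                 (sum-cong n₀ (λ s _ → negIf-≡ (Y (fold (n + s))) (≡.cong not (<ᵇ-false (ℕ.m≤m+n n s))))) ⟩
    sumℍ n (λ t → Y (fold t)) +ℍ sumℍ n₀ (λ s → -ℍ Y (fold (n + s)))  ≈⟨ +ℍ-cong (sum-fold-< Y) (sum-neg n₀ _) ⟩
    sumℍ n Y +ℍ (-ℍ sumℍ n₀ (λ s → Y (fold (n + s))))                  ≈⟨ +ℍ-cong (sum-head n₀ Y) (-ℍ-cong (sum-fold-+ Y)) ⟩
    (Y 0 +ℍ Z) +ℍ (-ℍ Z)                                                ≈⟨ +ℍ-assoc _ _ _ ⟩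
    Y 0 +ℍ (Z +ℍ (-ℍ Z))                                                ≈⟨ +ℍ-cong ≈ℍ-refl (-ℍ-inverseʳ Z) ⟩
    Y 0 +ℍ 0ℍ                                                           ≈⟨ +ℍ-identityʳ _ ⟩
    Y 0                                                                 ∎
    where
    open ℍ-Reasoning
    Z = sumℍ n₀ (λ s → Y (suc s))

module RowGramValues (R : StarCRing) (n₀ : ℕ) (H : HMat) (hadamard : IsQHadamard (suc n₀) H) where

  open SignedUnits R
  open Layout n₀ H
  open RowGram R n₀ H
  open FoldedSums R n₀
  open ColumnProducts R n H using (colProd)
  open ColumnOrthogonality n H hadamard R using (columns-orthogonal)
  open import Data.Nat using (_<_; _+_; _*_; _≡ᵇ_; _<ᵇ_; _≤ᵇ_)
  open import Data.Nat.Tactic.RingSolver using (solve-∀)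
  import Data.Bool.Properties as Bool
  open import Data.Product using (_,_)

  δ : ℕ → Bool → ℍ
  δ k c = if c then natℍ k else 0ℍ

  δ-+ : ∀ k l c → (δ k c +ℍ δ l c) ≈ℍ δ (k + l) c
  δ-+ k l true = ≈ℍ-sym (natℍ-+ k l)
  δ-+ k l false = +ℍ-identityˡ 0ℍ

  δ-double : ∀ c → (δ (n + n) c +ℍ δ (n + n) c) ≈ℍ δ (4 * n) c
  δ-double c = ≈ℍ-trans (δ-+ (n + n) (n + n) c) (≈ℍ-reflexive (≡.cong (λ k → δ k c) (four n)))
    where
    four : ∀ k → (k + k) + (k + k) ≡ 4 * k
    four = solve-∀

  Ĥ-< : ∀ {i} a → i < n → Ĥ i a ≡ H i (sel n a)
  Ĥ-< {i} a i<n rewrite ≤ᵇ-false i<n = ≡.refl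

  Ĥ-+ : ∀ i a → Ĥ (n + i) a ≡ (if n ≤ᵇ a then negSU (H i (sel n a)) else H i (sel n a))
  Ĥ-+ i a rewrite ≤ᵇ-true (ℕ.m≤m+n n i) | ℕ.m+n∸m≡n n₀ i = ≡.refl

  Ĥ-summand : ℕ → ℕ → ℕ → ℍ
  Ĥ-summand a b i = (evalSU (Ĥ i a) ℍ*) *ℍ evalSU (Ĥ i b)

  Ĥ-columns : ∀ {a b} → a < 2 * n → b < 2 * n → sumℍ (n + n) (Ĥ-summand a b) ≈ℍ δ (n + n) (a ≡ᵇ b)
  Ĥ-columns {a} {b} a<2n b<2n = begin
    sumℍ (n + n) (Ĥ-summand a b)                            ≈⟨ sum-split n n _ ⟩
    sumℍ n (Ĥ-summand a b) +ℍ sumℍ n (λ i → Ĥ-summand a b (n + i))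
      ≈⟨ +ℍ-cong (sum-cong n (λ i i<n → ≈ℍ-reflexive (≡.cong₂ (λ u v → (evalSU u ℍ*) *ℍ evalSU v) (Ĥ-< a i<n) (Ĥ-< b i<n))))
                 (≈ℍ-trans (sum-cong n (λ i _ → lower-half i)) (sum-negIf (sa xor sb) n _)) ⟩
    P +ℍ negIf (sa xor sb) P                                ≈⟨ halves ⟩
    δ (n + n) (a ≡ᵇ b)                                      ∎
    where
    open ℍ-Reasoning
    sa = n ≤ᵇ a
    sb = n ≤ᵇ b
    a′ = sel n a
    b′ = sel n b
    P = colProd a′ b′
    lower-half : ∀ i → Ĥ-summand a b (n + i) ≈ℍ negIf (sa xor sb) ((evalSU (H i a′) ℍ*) *ℍ evalSU (H i b′))
    lower-half i = begin
      Ĥ-summand a b (n + i)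
        ≈⟨ ≈ℍ-reflexive (≡.cong₂ (λ u v → (evalSU u ℍ*) *ℍ evalSU v) (Ĥ-+ i a) (Ĥ-+ i b)) ⟩
      (evalSU (if sa then negSU (H i a′) else H i a′) ℍ*) *ℍ evalSU (if sb then negSU (H i b′) else H i b′)
        ≈⟨ *ℍ-cong (ℍ*-cong (evalSU-negIf sa _)) (evalSU-negIf sb _) ⟩
      (negIf sa (evalSU (H i a′)) ℍ*) *ℍ negIf sb (evalSU (H i b′))
        ≈⟨ *ℍ-cong (negIf-ℍ* sa _) ≈ℍ-refl ⟩
      negIf sa (evalSU (H i a′) ℍ*) *ℍ negIf sb (evalSU (H i b′))
        ≈⟨ negIf-* sa sb _ _ ⟩
      negIf (sa xor sb) ((evalSU (H i a′) ℍ*) *ℍ evalSU (H i b′)) ∎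
    P≈ : P ≈ℍ δ n (a′ ≡ᵇ b′)
    P≈ = columns-orthogonal a′ b′ (sel<n a<2n) (sel<n b<2n)
    halves : (P +ℍ negIf (sa xor sb) P) ≈ℍ δ (n + n) (a ≡ᵇ b)
    halves with a ℕ.≟ b
    ... | yes ≡.refl rewrite ≡ᵇ-true {a} ≡.refl | Bool.xor-same sa =
      ≈ℍ-trans (+ℍ-cong P≈ P≈) (≈ℍ-trans (≈ℍ-reflexive (≡.cong (λ c → δ n c +ℍ δ n c) (≡ᵇ-true {a′} ≡.refl))) (δ-+ n n true))
    ... | no a≢b rewrite ≡ᵇ-false a≢b with a′ ℕ.≟ b′
    ...   | yes a′≡b′ = ≈ℍ-trans (+ℍ-cong ≈ℍ-refl (negIf-≡ P opposite)) (negIf-cancel false P)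
      where
      opposite : (sa xor sb) ≡ true
      opposite = ≡.trans (≡.cong (_xor sb) (sel-flip a≢b a′≡b′)) (Bool.xor-inverseˡ sb)
    ...   | no a′≢b′ =
      ≈ℍ-trans (+ℍ-cong P≈0 (negIf-cong (sa xor sb) P≈0)) (≈ℍ-trans (+ℍ-cong ≈ℍ-refl (negIf-0 (sa xor sb))) (+ℍ-identityˡ 0ℍ))
      where
      P≈0 : P ≈ℍ 0ℍ
      P≈0 = ≈ℍ-trans P≈ (≈ℍ-reflexive (≡.cong (δ n) (≡ᵇ-false a′≢b′)))

  rowGram-top : ∀ {a b} → a < 2 * n → b < 2 * n → rowGram (topRow a) (topRow b) ≈ℍ δ (4 * n) (a ≡ᵇ b)
  rowGram-top {a} {b} a<2n b<2n = begin
    rowGram (topRow a) (topRow b)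
      ≈⟨ +ℍ-cong (pair-same 0 false false false false _ _) (sum-cong m (λ l _ → pair-same 0 false false true true _ _)) ⟩
    (W 0 +ℍ W 0) +ℍ sumℍ m (λ l → W (suc l) +ℍ W (suc l))              ≈⟨ +ℍ-cong ≈ℍ-refl (sum-+ m _ _) ⟩
    (W 0 +ℍ W 0) +ℍ (sumℍ m (W ∘ suc) +ℍ sumℍ m (W ∘ suc))             ≈⟨ +ℍ-interchange _ _ _ _ ⟩
    (W 0 +ℍ sumℍ m (W ∘ suc)) +ℍ (W 0 +ℍ sumℍ m (W ∘ suc))             ≈⟨ +ℍ-cong whole whole ⟩
    δ (n + n) (a ≡ᵇ b) +ℍ δ (n + n) (a ≡ᵇ b)                            ≈⟨ δ-double (a ≡ᵇ b) ⟩
    δ (4 * n) (a ≡ᵇ b)                                                  ∎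
    where
    open ℍ-Reasoning
    W : ℕ → ℍ
    W i = evalSU (conjSU (Ĥ i a)) *ℍ (evalSU (conjSU (Ĥ i b)) ℍ*)
    whole : (W 0 +ℍ sumℍ m (W ∘ suc)) ≈ℍ δ (n + n) (a ≡ᵇ b)
    whole = begin
      W 0 +ℍ sumℍ m (W ∘ suc)       ≈⟨ sum-head m W ⟨
      sumℍ (suc m) W                ≈⟨ sum-congˡ W 1+m≡n+n ⟩
      sumℍ (n + n) W                ≈⟨ sum-cong (n + n) (λ i _ → conjSU-product (Ĥ i a) (Ĥ i b)) ⟩
      sumℍ (n + n) (Ĥ-summand a b)  ≈⟨ Ĥ-columns a<2n b<2n ⟩
      δ (n + n) (a ≡ᵇ b)            ∎

  private
    open import Data.Bool.Solver using (module xor-∧-Solver)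
    open xor-∧-Solver using (solve; _:=_; _:+_; _:*_; con)

    signs-top-block : ∀ b → b ≡ not (b xor true)
    signs-top-block = solve 1 (λ b → b := con true :+ (b :+ con true)) ≡.refl

    signs-top-wrap : ∀ b → (b ∧ false) ≡ not (true xor (not b ∧ false))
    signs-top-wrap = solve 1 (λ b → b :* con false := con true :+ (con true :+ ((con true :+ b) :* con false))) ≡.refl

    signs-shift : ∀ b b′ x′ → (b xor b′) ≡ not ((b xor not x′) xor (b′ xor x′))
    signs-shift = solve 3 (λ b b′ x → b :+ b′ := con true :+ ((b :+ (con true :+ x)) :+ (b′ :+ x))) ≡.refl

    signs-wrap : ∀ b b′ y′ → ((b ∧ not (not y′)) xor (b′ ∧ not y′)) ≡ not ((not b ∧ not (not y′)) xor (not b′ ∧ not y′))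
    signs-wrap = solve 3 (λ b b′ y → (b :* (con true :+ (con true :+ y))) :+ (b′ :* (con true :+ y))
                              := con true :+ (((con true :+ b) :* (con true :+ (con true :+ y))) :+ ((con true :+ b′) :* (con true :+ y))))
                         ≡.refl

    signs-same : ∀ b b′ x → ((b xor x) xor (b′ xor x)) ≡ (b xor b′)
    signs-same = solve 3 (λ b b′ x → (b :+ x) :+ (b′ :+ x) := b :+ b′) ≡.refl

    signs-same-wrap : ∀ b b′ w → ((not b ∧ w) xor (not b′ ∧ w)) ≡ ((b xor b′) ∧ w)
    signs-same-wrap = solve 3 (λ b b′ w → ((con true :+ b) :* w) :+ ((con true :+ b′) :* w) := (b :+ b′) :* w) ≡.refl

  rowGram-top-block : ∀ a b′ k′ r′ → k′ < m → rowGram (topRow a) (blockRow b′ k′ r′) ≈ℍ 0ℍ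
  rowGram-top-block a b′ k′ r′ k′<m = ≈ℍ-trans (+ℍ-cong top-pair (sum-zero m _ block-pair)) (+ℍ-identityˡ 0ℍ)
    where
    top-pair : pairTerm (topRow a) (blockRow b′ k′ r′) topPair ≈ℍ 0ℍ
    top-pair = pair-cancel 0 (sel n (suc k′)) false b′ false (b′ xor (n ≤ᵇ suc k′)) _ _
      (λ eq → ≡.subst (λ x → b′ ≡ not (b′ xor x)) (≡.sym (sel-1+≡0 k′ (≡.sym (≡ᵇ-sound eq)))) (signs-top-block b′))
    block-pair : ∀ l → l < m → pairTerm (topRow a) (blockRow b′ k′ r′) (blockPair l) ≈ℍ 0ℍ
    block-pair l l<m = pair-cancel 0 (fold t′) false (b′ ∧ wraps k′ l) true (not b′ ∧ wraps k′ l) _ _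
      (λ eq → ≡.subst (λ w → (b′ ∧ w) ≡ not (true xor (not b′ ∧ w)))
                      (≡.sym (≡.cong (λ t → not (t <ᵇ n)) (fold≡0 (circIdx<m k′<m l<m) (≡.sym (≡ᵇ-sound eq)))))
                      (signs-top-wrap b′))
      where t′ = circIdx k′ l

  rowGram-block-distinct : ∀ b k r b′ k′ r′ → k < m → k′ < m → k ≢ k′ → rowGram (blockRow b k r) (blockRow b′ k′ r′) ≈ℍ 0ℍ
  rowGram-block-distinct b k r b′ k′ r′ k<m k′<m k≢k′ = ≈ℍ-trans (+ℍ-cong top-pair (sum-zero m _ block-pair)) (+ℍ-identityˡ 0ℍ)
    where
    x′ = n ≤ᵇ suc k′
    top-pair : pairTerm (blockRow b k r) (blockRow b′ k′ r′) topPair ≈ℍ 0ℍ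
    top-pair = pair-cancel (sel n (suc k)) (sel n (suc k′)) b b′ (b xor (n ≤ᵇ suc k)) (b′ xor x′) _ _
      (λ eq → ≡.subst (λ x → (b xor b′) ≡ not ((b xor x) xor (b′ xor x′)))
                      (≡.sym (sel-flip (k≢k′ ∘ ℕ.suc-injective) (≡ᵇ-sound eq))) (signs-shift b b′ x′))
    block-pair : ∀ l → l < m → pairTerm (blockRow b k r) (blockRow b′ k′ r′) (blockPair l) ≈ℍ 0ℍ
    block-pair l l<m = pair-cancel (fold t) (fold t′) (b ∧ wraps k l) (b′ ∧ wraps k′ l) (not b ∧ wraps k l) (not b′ ∧ wraps k′ l) _ _
      (λ eq → ≡.subst (λ y → ((b ∧ not y) xor (b′ ∧ not y′)) ≡ not ((not b ∧ not y) xor (not b′ ∧ not y′)))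
                      (≡.sym (fold-flip (circIdx<m k<m l<m) (circIdx<m k′<m l<m)
                                        (k≢k′ ∘ circIdx-injective k<m k′<m l<m) (≡ᵇ-sound eq)))
                      (signs-wrap b b′ y′))
      where
      t = circIdx k l
      t′ = circIdx k′ l
      y′ = t′ <ᵇ n

  unitProduct : ℕ → ℕ → ℕ → ℍ
  unitProduct r r′ j = evalSU (conjSU (H j r)) *ℍ (evalSU (conjSU (H j r′)) ℍ*)

  sameBlock : Bool → ℕ → ℕ → ℕ → ℍ
  sameBlock β k r r′ = (negIf β (unitProduct r r′ 0) +ℍ negIf β (unitProduct r r′ 0)) +ℍ sumℍ m (λ l → blockTerm l +ℍ blockTerm l)
    where
    blockTerm : ℕ → ℍ
    blockTerm l = negIf (β ∧ wraps k l) (unitProduct r r′ (fold (circIdx k l)))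

  rowGram-block-same : ∀ b k r b′ r′ → rowGram (blockRow b k r) (blockRow b′ k r′) ≈ℍ sameBlock (b xor b′) k r r′
  rowGram-block-same b k r b′ r′ = +ℍ-cong
    (≈ℍ-trans (pair-same (sel n (suc k)) b b′ (b xor x) (b′ xor x) _ _) (+ℍ-cong ≈ℍ-refl (negIf-≡ _ (signs-same b b′ x))))
    (sum-cong m (λ l _ → ≈ℍ-trans (pair-same (fold (circIdx k l)) (b ∧ w l) (b′ ∧ w l) (not b ∧ w l) (not b′ ∧ w l) _ _)
                                   (+ℍ-cong (negIf-≡ _ (≡.sym (Bool.∧-distribʳ-xor (w l) b b′)))
                                            (negIf-≡ _ (signs-same-wrap b b′ (w l))))))
    where
    x = n ≤ᵇ suc k
    w = wraps k

  sum-unitProduct : ∀ {r r′} → r < n → r′ < n → sumℍ n (unitProduct r r′) ≈ℍ δ n (r ≡ᵇ r′)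
  sum-unitProduct {r} {r′} r<n r′<n =
    ≈ℍ-trans (sum-cong n (λ j _ → conjSU-product (H j r) (H j r′))) (columns-orthogonal r r′ r<n r′<n)

  sameBlock-aligned : ∀ {k r r′} → k < m → r < n → r′ < n → sameBlock false k r r′ ≈ℍ δ (4 * n) (r ≡ᵇ r′)
  sameBlock-aligned {k} {r} {r′} k<m r<n r′<n = begin
    (G 0 +ℍ G 0) +ℍ sumℍ m (λ l → G (fold (circIdx k l)) +ℍ G (fold (circIdx k l)))
      ≈⟨ +ℍ-cong ≈ℍ-refl (≈ℍ-trans (sum-+ m _ _) (+ℍ-cong rotated rotated)) ⟩
    (G 0 +ℍ G 0) +ℍ (sumℍ m (G ∘ fold) +ℍ sumℍ m (G ∘ fold))     ≈⟨ +ℍ-interchange _ _ _ _ ⟩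
    (G 0 +ℍ sumℍ m (G ∘ fold)) +ℍ (G 0 +ℍ sumℍ m (G ∘ fold))     ≈⟨ +ℍ-cong (sum-fold G) (sum-fold G) ⟩
    (sumℍ n G +ℍ sumℍ n G) +ℍ (sumℍ n G +ℍ sumℍ n G)            ≈⟨ +ℍ-cong twice twice ⟩
    δ (n + n) (r ≡ᵇ r′) +ℍ δ (n + n) (r ≡ᵇ r′)                  ≈⟨ δ-double (r ≡ᵇ r′) ⟩
    δ (4 * n) (r ≡ᵇ r′) ∎
    where
    open ℍ-Reasoning
    G = unitProduct r r′
    rotated = sum-rotate k (G ∘ fold) (ℕ.<⇒≤ k<m)
    twice : (sumℍ n G +ℍ sumℍ n G) ≈ℍ δ (n + n) (r ≡ᵇ r′)
    twice = ≈ℍ-trans (+ℍ-cong (sum-unitProduct r<n r′<n) (sum-unitProduct r<n r′<n)) (δ-+ n n (r ≡ᵇ r′))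

  sameBlock-opposite : ∀ {k r r′} → k < m → sameBlock true k r r′ ≈ℍ 0ℍ
  sameBlock-opposite {k} {r} {r′} k<m = begin
    ((-ℍ G 0) +ℍ (-ℍ G 0)) +ℍ sumℍ m (λ l → F (circIdx k l) +ℍ F (circIdx k l))
      ≈⟨ +ℍ-cong ≈ℍ-refl (≈ℍ-trans (sum-+ m _ _) (+ℍ-cong rotated rotated)) ⟩
    ((-ℍ G 0) +ℍ (-ℍ G 0)) +ℍ (sumℍ m F +ℍ sumℍ m F)        ≈⟨ +ℍ-cong ≈ℍ-refl (+ℍ-cong (sum-fold-signed G) (sum-fold-signed G)) ⟩
    ((-ℍ G 0) +ℍ (-ℍ G 0)) +ℍ (G 0 +ℍ G 0)                  ≈⟨ +ℍ-interchange _ _ _ _ ⟩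
    ((-ℍ G 0) +ℍ G 0) +ℍ ((-ℍ G 0) +ℍ G 0)                  ≈⟨ +ℍ-cong (-ℍ-inverseˡ _) (-ℍ-inverseˡ _) ⟩
    0ℍ +ℍ 0ℍ                                                ≈⟨ +ℍ-identityˡ 0ℍ ⟩
    0ℍ ∎
    where
    open ℍ-Reasoning
    G = unitProduct r r′
    F : ℕ → ℍ
    F t = negIf (not (t <ᵇ n)) (G (fold t))
    rotated = sum-rotate k F (ℕ.<⇒≤ k<m)

  rowGram-diagonal : ∀ κ → Valid κ → rowGram κ κ ≈ℍ natℍ (4 * n)
  rowGram-diagonal (topRow a) a<2n = ≈ℍ-trans (rowGram-top a<2n a<2n) (≈ℍ-reflexive (≡.cong (δ (4 * n)) (≡ᵇ-true {a} ≡.refl)))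
  rowGram-diagonal (blockRow b k r) (k<m , r<n) = begin
    rowGram (blockRow b k r) (blockRow b k r)  ≈⟨ rowGram-block-same b k r b r ⟩
    sameBlock (b xor b) k r r                  ≡⟨ ≡.cong (λ β → sameBlock β k r r) (Bool.xor-same b) ⟩
    sameBlock false k r r                      ≈⟨ sameBlock-aligned k<m r<n r<n ⟩
    δ (4 * n) (r ≡ᵇ r)                         ≡⟨ ≡.cong (δ (4 * n)) (≡ᵇ-true {r} ≡.refl) ⟩
    natℍ (4 * n)                               ∎
    where open ℍ-Reasoning

  rowGram-offDiagonal : ∀ κ κ′ → Valid κ → Valid κ′ → κ ≢ κ′ → rowGram κ κ′ ≈ℍ 0ℍ
  rowGram-offDiagonal (topRow a) (topRow a′) a<2n a′<2n κ≢κ′ =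
    ≈ℍ-trans (rowGram-top a<2n a′<2n) (≈ℍ-reflexive (≡.cong (δ (4 * n)) (≡ᵇ-false (κ≢κ′ ∘ ≡.cong topRow))))
  rowGram-offDiagonal (topRow a) (blockRow b′ k′ r′) _ (k′<m , _) _ = rowGram-top-block a b′ k′ r′ k′<m
  rowGram-offDiagonal (blockRow b k r) (topRow a′) (k<m , _) _ _ =
    ≈ℍ-trans (rowGram-sym (topRow a′) (blockRow b k r)) (≈ℍ-trans (ℍ*-cong (rowGram-top-block a′ b k r k<m)) ℍ*-0)
  rowGram-offDiagonal (blockRow b k r) (blockRow b′ k′ r′) (k<m , r<n) (k′<m , r′<n) κ≢κ′ with k ℕ.≟ k′
  ... | no k≢k′ = rowGram-block-distinct b k r b′ k′ r′ k<m k′<m k≢k′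
  ... | yes ≡.refl with b Bool.≟ b′
  ...   | yes ≡.refl = begin
    rowGram (blockRow b k r) (blockRow b k r′)  ≈⟨ rowGram-block-same b k r b r′ ⟩
    sameBlock (b xor b) k r r′                  ≡⟨ ≡.cong (λ β → sameBlock β k r r′) (Bool.xor-same b) ⟩
    sameBlock false k r r′                      ≈⟨ sameBlock-aligned k<m r<n r′<n ⟩
    δ (4 * n) (r ≡ᵇ r′)                         ≡⟨ ≡.cong (δ (4 * n)) (≡ᵇ-false (κ≢κ′ ∘ ≡.cong (blockRow b k))) ⟩
    0ℍ                                          ∎
    where open ℍ-Reasoning
  ...   | no b≢b′ = begin
    rowGram (blockRow b k r) (blockRow b′ k r′)  ≈⟨ rowGram-block-same b k r b′ r′ ⟩
    sameBlock (b xor b′) k r r′                  ≡⟨ ≡.cong (λ β → sameBlock β k r r′) b⊕b′≡true ⟩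
    sameBlock true k r r′                        ≈⟨ sameBlock-opposite k<m ⟩
    0ℍ                                           ∎
    where
    open ℍ-Reasoning
    b⊕b′≡true : (b xor b′) ≡ true
    b⊕b′≡true = ≡.trans (≡.cong (b xor_) (Bool.¬-not (b≢b′ ∘ ≡.sym))) (Bool.xor-inverseʳ b)

module RowOrthogonality (R : StarCRing) (n₀ : ℕ) {u : ℕ} (H : HMat) (X : SMat u) (hadamard : IsQHadamard (suc n₀) H) where

  open SignedUnits R
  open Layout n₀ H
  open RowGram R n₀ H using (rowGram)
  open RowGramValues R n₀ H hadamard using (δ; rowGram-diagonal; rowGram-offDiagonal)
  open RowPositions n₀ H X
  open import Data.Nat using (_*_; _≡ᵇ_)

  rowGram-positions : ∀ {p p′} → Position p → Position p′ →
    rowGram (kind (Co.region p)) (kind (Co.region p′)) ≈ℍ δ (4 * n) (p ≡ᵇ p′)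
  rowGram-positions {p} {p′} P P′ with p ℕ.≟ p′
  ... | yes ≡.refl = ≈ℍ-trans (rowGram-diagonal _ (valid-region P)) (≈ℍ-reflexive (≡.cong (δ (4 * n)) (≡.sym (≡ᵇ-true {p} ≡.refl))))
  ... | no p≢p′ = ≈ℍ-trans (rowGram-offDiagonal _ _ (valid-region P) (valid-region P′) kinds-differ)
                           (≈ℍ-reflexive (≡.cong (δ (4 * n)) (≡.sym (≡ᵇ-false p≢p′))))
    where
    kinds-differ : kind (Co.region p) ≢ kind (Co.region p′)
    kinds-differ eq = p≢p′ (≡.trans (≡.sym (index-kind P)) (≡.trans (≡.cong index eq) (index-kind P′)))

open import Data.Nat using (_*_; NonZero)

mainTheorem4 : (n : ℕ) .{{_ : NonZero n}} (u : ℕ) (s : Fin u → ℕ) (H : HMat) (X : SMat u) →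
    sumℕ s ≡ n → IsQOD u n X s → IsQHadamard n H →
    IsQOD u (4 * n * n) (X4n² n H X) (λ ℓ → 4 * n * s ℓ)
mainTheorem4 (suc n₀) u s H X _ isQOD hadamard R x p p′ p<N p′<N = begin
  rowInner (Co.region p) (Co.region p′)                       ≈⟨ rowInner≈rowGram _ _ (valid-region P) (valid-region P′) ⟩
  rowGram (kind (Co.region p)) (kind (Co.region p′)) *ℍ σ s x  ≈⟨ *ℍ-cong (rowGram-positions P P′) ≈ℍ-refl ⟩
  δ (4 * n) (p ℕ.≡ᵇ p′) *ℍ σ s x                              ≈⟨ scale (p ℕ.≡ᵇ p′) ⟩
  (if p ℕ.≡ᵇ p′ then σ (λ ℓ → 4 * n * s ℓ) x else 0ℍ)         ∎
  where
  open SignedUnits R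
  open Layout n₀ H using (n; kind)
  open RowPositions n₀ H X using (module Co; position; valid-region)
  open InnerProducts R n₀ H X s isQOD x using (rowInner; rowInner≈rowGram)
  open RowGram R n₀ H using (rowGram)
  open RowGramValues R n₀ H hadamard using (δ)
  open RowOrthogonality R n₀ H X hadamard using (rowGram-positions)
  open ℍ-Reasoning
  P = position p<N
  P′ = position p′<N
  scale : ∀ c → (δ (4 * n) c *ℍ σ s x) ≈ℍ (if c then σ (λ ℓ → 4 * n * s ℓ) x else 0ℍ)
  scale true = ≈ℍ-sym (Weights.σ-scale R s x (4 * n))
  scale false = *ℍ-zeroˡ (σ s x)
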